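{- Let $R$ be a binary gammoid and $Y\subseteq E(R)$ with $|Y|=k$, such that either $R_Y\cong M(F)$ or $R_Y/Y'\cong M(F)$ for some $Y'\subseteq Y$. Then there exist a binary gammoid $Q$ and an element $a\in E(Q)$ such that $Q\backslash a= M(F)$ and either $R=Q/a$ or $R$ is a coextension of $Q/a$ by at most $k$ elements.
   Context: For a binary matroid $N$ represented over $GF(2)$ by a matrix $A$ and $Y\subseteq E(N)$, the splitting matroid $N_Y$ is $M(A_Y)$, where $A_Y$ is obtained from $A$ by appending a bottom row with entry $1$ in the columns of elements of $Y$ and $0$ elsewhere. $F$ is the graph on three vertices $u,v,w$ with two parallel edges between $u$ and $v$, two parallel edges between $u$ and $w$, and one edge between $v$ and $w$; $M(F)$ is its cycle matroid. -}

module Defs where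

open import Data.Nat using (ℕ; zero; suc; _≤_)
open import Data.Fin using (Fin; zero; suc; inject₁; fromℕ)
open import Data.Fin.Subset using (Subset; _∈_; _∉_; _⊆_; _∪_; _─_; ⁅_⁆; ∣_∣; ⊤)
open import Data.Bool using (Bool; true; false; _∧_; _xor_)
open import Data.Vec using (lookup; tabulate)
open import Data.Product using (Σ; ∃; _×_; _,_)
open import Data.Sum using (_⊎_)
open import Relation.Nullary using (¬_)
open import Relation.Binary.PropositionalEquality using (_≡_; _≢_)
open import Function.Bundles using (_⇔_)

-- Matroids (as independence systems) living inside a finite universe
-- Fin size, with ground set E ⊆ Fin size.

record Matroid : Set₁ where
  field
    size  : ℕ
    E     : Subset size
    Indep : Subset size → Set
open Matroid public

_∖_ : (M : Matroid) → Subset (size M) → Matroid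
M ∖ X = record
  { size  = size M
  ; E     = E M ─ X
  ; Indep = λ I → I ⊆ (E M ─ X) × Indep M I }

IsBasisOf : (M : Matroid) → Subset (size M) → Subset (size M) → Set
IsBasisOf M J T = J ⊆ T × Indep M J
                × (∀ x → x ∈ T → x ∉ J → ¬ Indep M (J ∪ ⁅ x ⁆))

_／_ : (M : Matroid) → Subset (size M) → Matroid
M ／ T = record
  { size  = size M
  ; E     = E M ─ T
  ; Indep = λ I → I ⊆ (E M ─ T)
                × Σ (Subset (size M)) (λ J → IsBasisOf M J T × Indep M (I ∪ J)) }

_≅_ : Matroid → Matroid → Set
M ≅ N =
  Σ (Fin (size M) → Fin (size N)) λ f →
  Σ (Fin (size N) → Fin (size M)) λ g →
    (∀ x → x ∈ E M → f x ∈ E N)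
  × (∀ y → y ∈ E N → g y ∈ E M)
  × (∀ x → x ∈ E M → g (f x) ≡ x)
  × (∀ y → y ∈ E N → f (g y) ≡ y)
  × (∀ I J → I ⊆ E M → J ⊆ E N
       → (∀ x → x ∈ E M → (x ∈ I ⇔ f x ∈ J))
       → (Indep M I ⇔ Indep N J))

Matrix : ℕ → ℕ → Set
Matrix m n = Fin m → Fin n → Bool

xorSum : {n : ℕ} → (Fin n → Bool) → Bool
xorSum {zero}  f = false
xorSum {suc n} f = f zero xor xorSum (λ i → f (suc i))

colSum : {m n : ℕ} → Matrix m n → Subset n → Fin m → Bool
colSum A C i = xorSum (λ j → lookup C j ∧ A i j)

-- the vector matroid M(A): I independent iff the columns in I are
-- linearly independent over GF(2), i.e. the only subset of I whose
-- columns sum to 0 is the empty one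
M[_] : {m n : ℕ} → Matrix m n → Matroid
M[_] {m} {n} A = record
  { size  = n
  ; E     = ⊤
  ; Indep = λ I → ∀ (C : Subset n) → C ⊆ I → (∀ i → colSum A C i ≡ false)
                  → ∀ j → j ∉ C }

appendRow : {m n : ℕ} → Matrix m n → (Fin n → Bool) → Matrix (suc m) n
appendRow {zero}  A r zero    = r
appendRow {suc m} A r zero    = A zero
appendRow {suc m} A r (suc i) = appendRow (λ i' → A (suc i')) r i

-- A_Y: bottom row has 1 exactly in the columns of Y
splitMatrix : {m n : ℕ} → Matrix m n → Subset n → Matrix (suc m) n
splitMatrix A Y = appendRow A (lookup Y)

splitting : {m n : ℕ} → Matrix m n → Subset n → Matroid
splitting A Y = M[ splitMatrix A Y ]

record Digraph : Set where
  field
    nV  : ℕ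
    arc : Fin nV → Fin nV → Bool
open Digraph public

record PathTo (D : Digraph) (B : Subset (nV D)) (s : Fin (nV D)) : Set where
  field
    len    : ℕ
    vert   : Fin (suc len) → Fin (nV D)
    start  : vert zero ≡ s
    finish : vert (fromℕ len) ∈ B
    arcs   : ∀ (i : Fin len) → arc D (vert (inject₁ i)) (vert (suc i)) ≡ true
    simple : ∀ i j → vert i ≡ vert j → i ≡ j
open PathTo public

LinkedVia : (D : Digraph) (B : Subset (nV D)) {n : ℕ}
            (φ : Fin n → Fin (nV D)) → Subset n → Set
LinkedVia D B φ I =
  Σ (∀ x → x ∈ I → PathTo D B (φ x)) λ P →
    ∀ x y (hx : x ∈ I) (hy : y ∈ I) → x ≢ y
      → ∀ i j → vert (P x hx) i ≢ vert (P y hy) j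

-- M is a gammoid: it is (isomorphic to) the restriction, to a subset of
-- the vertices, of a strict gammoid L(D,B) of a finite digraph D
IsGammoid : Matroid → Set
IsGammoid M =
  Σ Digraph λ D → Σ (Subset (nV D)) λ B → Σ (Fin (size M) → Fin (nV D)) λ φ →
      (∀ x y → x ∈ E M → y ∈ E M → φ x ≡ φ y → x ≡ y)
    × (∀ I → I ⊆ E M → (Indep M I ⇔ LinkedVia D B φ I))

record Graph : Set where
  field
    nVert : ℕ
    nEdge : ℕ
    ends  : Fin nEdge → Fin nVert × Fin nVert
open Graph public

Joins : (G : Graph) → Fin (nEdge G) → Fin (nVert G) → Fin (nVert G) → Set
Joins G e a b = ends G e ≡ (a , b) ⊎ ends G e ≡ (b , a)

record CycleIn (G : Graph) (I : Subset (nEdge G)) : Set where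
  field
    k      : ℕ
    k≥1    : 1 ≤ k
    cv     : Fin (suc k) → Fin (nVert G)
    closed : cv (fromℕ k) ≡ cv zero
    ce     : Fin k → Fin (nEdge G)
    joins  : ∀ i → Joins G (ce i) (cv (inject₁ i)) (cv (suc i))
    inI    : ∀ i → ce i ∈ I
    cvInj  : ∀ i j → cv (inject₁ i) ≡ cv (inject₁ j) → i ≡ j
    ceInj  : ∀ i j → ce i ≡ ce j → i ≡ j

cycleMatroid : Graph → Matroid
cycleMatroid G = record
  { size  = nEdge G
  ; E     = ⊤
  ; Indep = λ I → ¬ CycleIn G I }

-- The graph F: vertices u=0, v=1, w=2; edges two u–v, two u–w, one v–w
F-ends : Fin 5 → Fin 3 × Fin 3
F-ends zero                         = (zero , suc zero)
F-ends (suc zero)                   = (zero , suc zero)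
F-ends (suc (suc zero))             = (zero , suc (suc zero))
F-ends (suc (suc (suc zero)))       = (zero , suc (suc zero))
F-ends (suc (suc (suc (suc zero)))) = (suc zero , suc (suc zero))

F : Graph
F = record { nVert = 3 ; nEdge = 5 ; ends = F-ends }

MF : Matroid
MF = cycleMatroid F

CoextensionAtMost : Matroid → Matroid → ℕ → Set
CoextensionAtMost R N k =
  Σ (Subset (size R)) λ T → T ⊆ E R × ∣ T ∣ ≤ k × (R ／ T) ≅ N

-- Let T be the contracted subset of Y (T = ∅ when N_Y ≅ M(F) itself). A contraction
-- M[A] / T is determined by its cycle space: the restrictions to E − T of the null
-- vectors of A. The null vectors of even weight on Y give the cycle space of
-- N_Y / T ≅ M(F), the null space of the incidence matrix R of F; those of odd weight
-- give either nothing or one coset {c | R c = d}. Hence M[A] / T = M[d | R] / a for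
-- the new column a = d, while M[d | R] \ a = M[R] = M(F). Finally every binary matroid
-- of rank at most 2 is a gammoid: send each element to a hub vertex for its column
-- vector and each hub to the (at most two) rows in which that vector is 1; the sets
-- linked to these rows are exactly the sets of at most two distinct nonzero columns.

module Submission where

open import Defs
open import Algebra.Bundles using (CommutativeRing)
open import Data.Bool using (Bool; true; false; _∧_; _xor_; not; if_then_else_)
open import Data.Bool.Properties
  using (xor-∧-commutativeRing; ∧-distribʳ-xor; xor-same; xor-identityʳ; xor-assoc) renaming (_≟_ to _≟ᵇ_)
import Data.Empty
open import Data.Empty using (⊥-elim)
open import Data.Fin using (Fin; zero; suc; fromℕ; inject₁; _≟_; join; splitAt)
open import Data.Fin.Properties using (all?; any?; splitAt-join; join-splitAt)
open import Data.Fin.Subset using (Subset; _∈_; _∉_; _⊆_; _∪_; _∩_; _─_; ⁅_⁆; ∣_∣; ⊤; ⊥)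
open import Data.Fin.Subset.Properties
  using ( anySubset?; _∈?_; _⊆?_; ∈⊤; ∉⊥; ⊥⊆; x∈⁅x⁆; x∈⁅y⁆⇒x≡y; x≢y⇒x∉⁅y⁆; drop-there
        ; x∈p∪q⁻; x∈p∪q⁺; p⊆p∪q; q⊆p∪q; x∈p∩q⁻; x∈p∧x∉q⇒x∈p─q; p─q⊆p; p⊆q⇒∣p∣≤∣q∣ )
open import Data.List using (List; []; _∷_; allFin)
open import Data.List.Membership.Propositional using () renaming (_∈_ to _∈ₗ_)
open import Data.List.Membership.Propositional.Properties using (∈-allFin)
open import Data.List.Relation.Unary.Any using () renaming (here to hereₗ; there to thereₗ)
open import Data.Nat using (ℕ; zero; suc; _+_; _≤_; s≤s; z≤n)
open import Data.Product using (Σ; _×_; _,_; proj₁; proj₂; swap)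
open import Data.Product.Properties using (≡-dec; swap-involutive)
import Data.Sum as Sum
open import Data.Sum using (_⊎_; inj₁; inj₂; [_,_]′)
open import Data.Sum.Function.Propositional using (_⊎-⇔_)
open import Data.Vec using (Vec; []; _∷_; lookup; tabulate; zipWith; replicate; here; there)
open import Data.Vec.Properties
  using ([]=⇒lookup; lookup⇒[]=; lookup-zipWith; lookup-replicate; lookup∘tabulate; tabulate∘lookup; tabulate-cong)
  renaming (≡-dec to ≡-decᵛ)
open import Function using (_∘_; id; case_of_)
open import Function.Bundles using (_⇔_; mk⇔; Equivalence)
open import Function.Construct.Composition using (_⇔-∘_)
open import Function.Construct.Symmetry using (⇔-sym)
open import Function.Properties.Equivalence using (⇔-setoid)
open import Level using (0ℓ)
open import Relation.Binary.PropositionalEquality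
  using (_≡_; _≢_; refl; sym; trans; cong; cong₂; subst; subst₂; _≗_; module ≡-Reasoning)
import Relation.Binary.Reasoning.Setoid as SetoidReasoning
open import Relation.Nullary using (¬_; Dec; yes; no; does)
open import Relation.Nullary.Decidable
  using (map′; ¬?; _→-dec_; _×-dec_; _⊎-dec_; decidable-stable; True; toWitness; dec-true)
open import Relation.Unary using (Decidable)

open import Algebra.Properties.CommutativeSemigroup
  (CommutativeRing.+-commutativeSemigroup xor-∧-commutativeRing) using (interchange)

private
  variable
    m n p : ℕ

-- Subsets as vectors over GF(2)

module _ {p : Subset n} {x : Fin n} where

  ∈⇒lookup : x ∈ p → lookup p x ≡ true
  ∈⇒lookup = []=⇒lookup

  lookup⇒∈ : lookup p x ≡ true → x ∈ p
  lookup⇒∈ = lookup⇒[]= x p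

  lookup⇒∉ : lookup p x ≡ false → x ∉ p
  lookup⇒∉ eq x∈p with () ← trans (sym (∈⇒lookup x∈p)) eq

  ∉⇒lookup : x ∉ p → lookup p x ≡ false
  ∉⇒lookup x∉p with lookup p x in eq
  ... | true  = ⊥-elim (x∉p (lookup⇒∈ eq))
  ... | false = refl

infixr 6 _⊕_

_⊕_ : Subset n → Subset n → Subset n
_⊕_ = zipWith _xor_

lookup-⊕ : (p q : Subset n) (x : Fin n) → lookup (p ⊕ q) x ≡ lookup p x xor lookup q x
lookup-⊕ p q x = lookup-zipWith _xor_ x p q

module _ {x : Fin n} {p q : Subset n} where

  ∈-⊕⁻ : x ∈ p ⊕ q → x ∈ p ⊎ x ∈ q
  ∈-⊕⁻ x∈ with lookup p x in eq
  ... | true  = inj₁ (lookup⇒∈ eq)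
  ... | false = inj₂ (lookup⇒∈ (trans (sym (cong (_xor lookup q x) eq)) (trans (sym (lookup-⊕ p q x)) (∈⇒lookup x∈))))

  ∉-⊕ : x ∈ p → x ∈ q → x ∉ p ⊕ q
  ∉-⊕ x∈p x∈q = lookup⇒∉ (trans (lookup-⊕ p q x) (cong₂ _xor_ (∈⇒lookup x∈p) (∈⇒lookup x∈q)))

  ∈-⊕ˡ : x ∈ p → x ∉ q → x ∈ p ⊕ q
  ∈-⊕ˡ x∈p x∉q = lookup⇒∈ (trans (lookup-⊕ p q x) (cong₂ _xor_ (∈⇒lookup x∈p) (∉⇒lookup x∉q)))

  ∈-⊕ʳ : x ∉ p → x ∈ q → x ∈ p ⊕ q
  ∈-⊕ʳ x∉p x∈q = lookup⇒∈ (trans (lookup-⊕ p q x) (cong₂ _xor_ (∉⇒lookup x∉p) (∈⇒lookup x∈q)))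

∈─⇒∉ : (p q : Subset n) {x : Fin n} → x ∈ p ─ q → x ∉ q
∈─⇒∉ (_ ∷ p) (true  ∷ q) ()        here
∈─⇒∉ (_ ∷ p) (false ∷ q) here      ()
∈─⇒∉ (_ ∷ p) (_     ∷ q) (there x∈) (there x∈q) = ∈─⇒∉ p q x∈ x∈q

∈-pair : {x j y : Fin n} → j ≢ y → x ∈ ⁅ j ⁆ ⊕ ⁅ y ⁆ ⇔ (x ≡ j ⊎ x ≡ y)
∈-pair {j = j} {y} j≢y = mk⇔ (Sum.map (x∈⁅y⁆⇒x≡y j) (x∈⁅y⁆⇒x≡y y) ∘ ∈-⊕⁻)
  λ { (inj₁ refl) → ∈-⊕ˡ (x∈⁅x⁆ j) (x≢y⇒x∉⁅y⁆ j≢y)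
    ; (inj₂ refl) → ∈-⊕ʳ (x≢y⇒x∉⁅y⁆ (j≢y ∘ sym)) (x∈⁅x⁆ y) }

lookup-ext : {p q : Subset n} → lookup p ≗ lookup q → p ≡ q
lookup-ext {p = p} {q} p≗q = trans (sym (tabulate∘lookup p)) (trans (tabulate-cong p≗q) (tabulate∘lookup q))

xor≡false⇒≡ : ∀ {a b} → a xor b ≡ false → a ≡ b
xor≡false⇒≡ {false} {false} _ = refl
xor≡false⇒≡ {true}  {true}  _ = refl

≡⇒xor≡false : ∀ {a b} → a ≡ b → a xor b ≡ false
≡⇒xor≡false {a} refl = xor-same a

⊕-cancelʳ : (p q : Subset n) → (p ⊕ q) ⊕ q ≡ p
⊕-cancelʳ p q = lookup-ext λ x → begin
  lookup ((p ⊕ q) ⊕ q) x               ≡⟨ trans (lookup-⊕ (p ⊕ q) q x) (cong (_xor lookup q x) (lookup-⊕ p q x)) ⟩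
  (lookup p x xor lookup q x) xor lookup q x ≡⟨ xor-assoc (lookup p x) (lookup q x) (lookup q x) ⟩
  lookup p x xor (lookup q x xor lookup q x) ≡⟨ cong (lookup p x xor_) (xor-same (lookup q x)) ⟩
  lookup p x xor false                  ≡⟨ xor-identityʳ (lookup p x) ⟩
  lookup p x                            ∎
  where open ≡-Reasoning

empty-⊕⇒≡ : {p q : Subset n} → (∀ j → j ∉ p ⊕ q) → p ≡ q
empty-⊕⇒≡ {p = p} {q} empty = lookup-ext λ j → xor≡false⇒≡ (trans (sym (lookup-⊕ p q j)) (∉⇒lookup (empty j)))

xorSum-cong : {f g : Fin n → Bool} → f ≗ g → xorSum f ≡ xorSum g
xorSum-cong {zero}  f≗g = refl
xorSum-cong {suc n} f≗g = cong₂ _xor_ (f≗g zero) (xorSum-cong (f≗g ∘ suc))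

xorSum-xor : (f g : Fin n → Bool) → xorSum (λ j → f j xor g j) ≡ xorSum f xor xorSum g
xorSum-xor {zero}  f g = refl
xorSum-xor {suc n} f g = trans (cong ((f zero xor g zero) xor_) (xorSum-xor (f ∘ suc) (g ∘ suc)))
                               (interchange (f zero) (g zero) _ _)

xorSum-false : {f : Fin n → Bool} → (∀ j → f j ≡ false) → xorSum f ≡ false
xorSum-false {zero}  f≡false = refl
xorSum-false {suc n} f≡false rewrite f≡false zero = xorSum-false (f≡false ∘ suc)

Null : Matrix m n → Subset n → Set
Null A C = ∀ i → colSum A C i ≡ false

null-⊥ : (A : Matrix m n) → Null A ⊥
null-⊥ A i = xorSum-false λ j → cong (_∧ A i j) (lookup-replicate j false)

colSum-⊕ : (A : Matrix m n) (p q : Subset n) → ∀ i → colSum A (p ⊕ q) i ≡ colSum A p i xor colSum A q i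
colSum-⊕ A p q i = trans
  (xorSum-cong (λ j → trans (cong (_∧ A i j) (lookup-⊕ p q j)) (∧-distribʳ-xor (A i j) (lookup p j) (lookup q j))))
  (xorSum-xor (λ j → lookup p j ∧ A i j) (λ j → lookup q j ∧ A i j))

colSum-⁅⁆ : (A : Matrix m n) (t : Fin n) → ∀ i → colSum A ⁅ t ⁆ i ≡ A i t
colSum-⁅⁆ {n = suc n} A zero    i = trans (cong (A i zero xor_) (null-⊥ (λ i j → A i (suc j)) i)) (xor-identityʳ _)
colSum-⁅⁆ {n = suc n} A (suc t) i = colSum-⁅⁆ (λ i j → A i (suc j)) t i

null-⊕ : (A : Matrix m n) {p q : Subset n} → Null A p → Null A q → Null A (p ⊕ q)
null-⊕ A {p} {q} Np Nq i = trans (colSum-⊕ A p q i) (cong₂ _xor_ (Np i) (Nq i))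

colSum-closed : (A : Matrix m n) (S : (Fin m → Bool) → Set)
  → S (λ _ → false) → (∀ {u v} → S u → S v → S (λ i → u i xor v i))
  → (X : Subset n) → (∀ t → t ∈ X → S (λ i → A i t)) → S (colSum A X)
colSum-closed {n = zero}  A S S0 S⊕ []          _ = S0
colSum-closed {n = suc n} A S S0 S⊕ (false ∷ X) SX =
  colSum-closed (λ i j → A i (suc j)) S S0 S⊕ X (λ t → SX (suc t) ∘ there)
colSum-closed {n = suc n} A S S0 S⊕ (true ∷ X)  SX =
  S⊕ (SX zero here) (colSum-closed (λ i j → A i (suc j)) S S0 S⊕ X (λ t → SX (suc t) ∘ there))

allSubsets? : {P : Subset n → Set} → Decidable P → Dec (∀ C → P C)
allSubsets? P? with anySubset? (¬? ∘ P?)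
... | yes (C , ¬PC) = no (λ ∀P → ¬PC (∀P C))
... | no ¬∃        = yes (λ C → decidable-stable (P? C) (λ ¬PC → ¬∃ (C , ¬PC)))

null? : (A : Matrix m n) → Decidable (Null A)
null? A C = all? (λ i → colSum A C i ≟ᵇ false)

independent? : (A : Matrix m n) → Decidable (Indep M[ A ])
independent? A I = allSubsets? (λ C → C ⊆? I →-dec (null? A C →-dec all? (λ j → ¬? (j ∈? C))))

∀-Bool? : {P : Bool → Set} → Decidable P → Dec (∀ b → P b)
∀-Bool? P? = map′ (λ { (Pt , Pf) true → Pt ; (Pt , Pf) false → Pf }) (λ ∀P → ∀P true , ∀P false) (P? true ×-dec P? false)

does⇒ : {A : Set} (a? : Dec A) → does a? ≡ true → A
does⇒ (yes a) _ = a

-- Contractions of vector matroids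

∪-monoˡ : {p q : Subset n} (r : Subset n) → p ⊆ q → p ∪ r ⊆ q ∪ r
∪-monoˡ {p = p} r p⊆q x∈ = x∈p∪q⁺ (Sum.map₁ p⊆q (x∈p∪q⁻ p r x∈))

∪-monoʳ : (r : Subset n) {p q : Subset n} → p ⊆ q → r ∪ p ⊆ r ∪ q
∪-monoʳ r {p} p⊆q x∈ = x∈p∪q⁺ (Sum.map₂ p⊆q (x∈p∪q⁻ r p x∈))

─-⊕-∩ : (p q : Subset n) → p ≡ (p ─ q) ⊕ (p ∩ q)
─-⊕-∩ []      []      = refl
─-⊕-∩ (false ∷ p) (false ∷ q) = cong (false ∷_) (─-⊕-∩ p q)
─-⊕-∩ (false ∷ p) (true  ∷ q) = cong (false ∷_) (─-⊕-∩ p q)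
─-⊕-∩ (true  ∷ p) (false ∷ q) = cong (true ∷_) (─-⊕-∩ p q)
─-⊕-∩ (true  ∷ p) (true  ∷ q) = cong (true ∷_) (─-⊕-∩ p q)

indep-⊆ : (A : Matrix m n) {I J : Subset n} → J ⊆ I → Indep M[ A ] I → Indep M[ A ] J
indep-⊆ A J⊆I indI C C⊆J = indI C (J⊆I ∘ C⊆J)

InSpan : Matrix m n → Subset n → (Fin m → Bool) → Set
InSpan A J v = Σ (Subset _) λ K → K ⊆ J × (∀ i → colSum A K i ≡ v i)

inSpan? : (A : Matrix m n) (J : Subset n) (v : Fin m → Bool) → Dec (InSpan A J v)
inSpan? A J v = anySubset? (λ K → K ⊆? J ×-dec all? (λ i → colSum A K i ≟ᵇ v i))

colSum-inSpan : (A : Matrix m n) {J : Subset n} (X : Subset n)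
  → (∀ t → t ∈ X → InSpan A J (λ i → A i t)) → InSpan A J (colSum A X)
colSum-inSpan A {J} = colSum-closed A (InSpan A J) (⊥ , ⊥⊆ , null-⊥ A)
  λ { (K , K⊆J , K≡u) (L , L⊆J , L≡v) →
      K ⊕ L , [ K⊆J , L⊆J ]′ ∘ ∈-⊕⁻ , λ i → trans (colSum-⊕ A K L i) (cong₂ _xor_ (K≡u i) (L≡v i)) }

basis-spans : (A : Matrix m n) {J T : Subset n} → IsBasisOf M[ A ] J T
  → ∀ t → t ∈ T → InSpan A J (λ i → A i t)
basis-spans A {J} {T} (J⊆T , indJ , maximal) t t∈T with t ∈? J
... | yes t∈J = ⁅ t ⁆ , (λ x∈ → subst (_∈ J) (sym (x∈⁅y⁆⇒x≡y t x∈)) t∈J) , colSum-⁅⁆ A t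
... | no  t∉J with inSpan? A J (λ i → A i t)
...   | yes spans = spans
...   | no ¬spans = ⊥-elim (maximal t t∈T t∉J indJ∪t)
  where
  indJ∪t : Indep M[ A ] (J ∪ ⁅ t ⁆)
  indJ∪t C C⊆J∪t nullC with t ∈? C
  ... | no t∉C = indJ C C⊆J nullC
    where
    C⊆J : C ⊆ J
    C⊆J x∈C with x∈p∪q⁻ J ⁅ t ⁆ (C⊆J∪t x∈C)
    ... | inj₁ x∈J = x∈J
    ... | inj₂ x∈t = ⊥-elim (t∉C (subst (_∈ C) (x∈⁅y⁆⇒x≡y t x∈t) x∈C))
  ... | yes t∈C = ⊥-elim (¬spans (C ⊕ ⁅ t ⁆ , K⊆J ,
                    λ i → trans (colSum-⊕ A C ⁅ t ⁆ i) (cong₂ _xor_ (nullC i) (colSum-⁅⁆ A t i))))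
    where
    x∉t : ∀ {x} → x ∈ C ⊕ ⁅ t ⁆ → x ∉ ⁅ t ⁆
    x∉t x∈K x∈t = ∉-⊕ t∈C (x∈⁅x⁆ t) (subst (_∈ C ⊕ ⁅ t ⁆) (x∈⁅y⁆⇒x≡y t x∈t) x∈K)
    K⊆J : C ⊕ ⁅ t ⁆ ⊆ J
    K⊆J x∈K with ∈-⊕⁻ x∈K
    ... | inj₂ x∈t = ⊥-elim (x∉t x∈K x∈t)
    ... | inj₁ x∈C with x∈p∪q⁻ J ⁅ t ⁆ (C⊆J∪t x∈C)
    ...   | inj₁ x∈J = x∈J
    ...   | inj₂ x∈t = ⊥-elim (x∉t x∈K x∈t)

module _ (A : Matrix m n) (T : Subset n) where

  private
    Saturated : List (Fin n) → Subset n → Set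
    Saturated xs J = ∀ x → x ∈ₗ xs → x ∈ T → x ∉ J → ¬ Indep M[ A ] (J ∪ ⁅ x ⁆)

    extend : (xs : List (Fin n)) (J : Subset n) → J ⊆ T → Indep M[ A ] J
      → Σ (Subset n) λ J′ → J ⊆ J′ × J′ ⊆ T × Indep M[ A ] J′ × Saturated xs J′
    extend [] J J⊆T indJ = J , id , J⊆T , indJ , λ _ ()
    extend (x ∷ xs) J J⊆T indJ with x ∈? T | independent? A (J ∪ ⁅ x ⁆)
    ... | yes x∈T | yes indJ∪x =
      let (J′ , J∪x⊆J′ , J′⊆T , indJ′ , sat) = extend xs (J ∪ ⁅ x ⁆) J∪x⊆T indJ∪x
      in  J′ , J∪x⊆J′ ∘ p⊆p∪q ⁅ x ⁆ , J′⊆T , indJ′ ,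
          λ { y (hereₗ refl) _ y∉J′ → ⊥-elim (y∉J′ (J∪x⊆J′ (q⊆p∪q J ⁅ x ⁆ (x∈⁅x⁆ x))))
            ; y (thereₗ y∈) → sat y y∈ }
      where
      J∪x⊆T : J ∪ ⁅ x ⁆ ⊆ T
      J∪x⊆T y∈ = [ J⊆T , (λ y∈x → subst (_∈ T) (sym (x∈⁅y⁆⇒x≡y x y∈x)) x∈T) ]′ (x∈p∪q⁻ J ⁅ x ⁆ y∈)
    ... | yes x∈T | no ¬indJ∪x =
      let (J′ , J⊆J′ , J′⊆T , indJ′ , sat) = extend xs J J⊆T indJ
      in  J′ , J⊆J′ , J′⊆T , indJ′ ,
          λ { y (hereₗ refl) _ _ indJ′∪x → ¬indJ∪x (indep-⊆ A (∪-monoˡ ⁅ x ⁆ J⊆J′) indJ′∪x)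
            ; y (thereₗ y∈) → sat y y∈ }
    ... | no x∉T | _ =
      let (J′ , J⊆J′ , J′⊆T , indJ′ , sat) = extend xs J J⊆T indJ
      in  J′ , J⊆J′ , J′⊆T , indJ′ ,
          λ { y (hereₗ refl) x∈T → ⊥-elim (x∉T x∈T) ; y (thereₗ y∈) → sat y y∈ }

  basis-exists : Σ (Subset n) λ J → IsBasisOf M[ A ] J T
  basis-exists =
    let (J , _ , J⊆T , indJ , sat) = extend (allFin n) ⊥ ⊥⊆ (λ C C⊆⊥ _ j j∈C → ∉⊥ (C⊆⊥ j∈C))
    in  J , J⊆T , indJ , λ x → sat x (∈-allFin x)

IndepModulo : Matrix m n → Subset n → Subset n → Set
IndepModulo A T I = ∀ C → C ⊆ I ∪ T → Null A C → ∀ j → j ∈ I → j ∉ C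

indep-／⇔ : (A : Matrix m n) (T I : Subset n) → Indep (M[ A ] ／ T) I ⇔ (I ⊆ ⊤ ─ T × IndepModulo A T I)
indep-／⇔ {n = n} A T I = mk⇔ to from
  where
  open ≡-Reasoning
  to : Indep (M[ A ] ／ T) I → I ⊆ ⊤ ─ T × IndepModulo A T I
  to (I⊆E , J , basisJ@(J⊆T , _ , _) , indI∪J) = I⊆E , indMod
    where
    -- The part of C inside T is traded for columns of the basis J with the same sum.
    indMod : IndepModulo A T I
    indMod C C⊆I∪T nullC j j∈I j∈C = indI∪J D D⊆I∪J nullD j j∈D
      where
      j∉T : j ∉ T
      j∉T = ∈─⇒∉ ⊤ T (I⊆E j∈I)
      spanned : InSpan A J (colSum A (C ∩ T))
      spanned = colSum-inSpan A (C ∩ T) (λ t t∈ → basis-spans A basisJ t (proj₂ (x∈p∩q⁻ C T t∈)))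
      K : Subset n
      K = proj₁ spanned
      K⊆J : K ⊆ J
      K⊆J = proj₁ (proj₂ spanned)
      D : Subset n
      D = (C ─ T) ⊕ K
      nullD : Null A D
      nullD i = begin
        colSum A D i                                          ≡⟨ colSum-⊕ A (C ─ T) K i ⟩
        colSum A (C ─ T) i xor colSum A K i                   ≡⟨ cong (colSum A (C ─ T) i xor_) (proj₂ (proj₂ spanned) i) ⟩
        colSum A (C ─ T) i xor colSum A (C ∩ T) i             ≡⟨ sym (colSum-⊕ A (C ─ T) (C ∩ T) i) ⟩
        colSum A ((C ─ T) ⊕ (C ∩ T)) i                        ≡⟨ cong (λ X → colSum A X i) (sym (─-⊕-∩ C T)) ⟩
        colSum A C i                                          ≡⟨ nullC i ⟩
        false                                                 ∎
      C─T⊆I : C ─ T ⊆ I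
      C─T⊆I {x} x∈ = [ id , (λ x∈T → ⊥-elim (∈─⇒∉ C T x∈ x∈T)) ]′ (x∈p∪q⁻ I T (C⊆I∪T (p─q⊆p C T x∈)))
      D⊆I∪J : D ⊆ I ∪ J
      D⊆I∪J x∈D = x∈p∪q⁺ (Sum.map C─T⊆I K⊆J (∈-⊕⁻ x∈D))
      j∈D : j ∈ D
      j∈D = ∈-⊕ˡ (x∈p∧x∉q⇒x∈p─q j∈C j∉T) (j∉T ∘ J⊆T ∘ K⊆J)
  from : I ⊆ ⊤ ─ T × IndepModulo A T I → Indep (M[ A ] ／ T) I
  from (I⊆E , indMod) = I⊆E , J , basisJ , indI∪J
    where
    J : Subset n
    J = proj₁ (basis-exists A T)
    basisJ : IsBasisOf M[ A ] J T
    basisJ = proj₂ (basis-exists A T)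
    indI∪J : Indep M[ A ] (I ∪ J)
    indI∪J C C⊆I∪J nullC = proj₁ (proj₂ basisJ) C C⊆J nullC
      where
      C⊆I∪T : C ⊆ I ∪ T
      C⊆I∪T x∈C = ∪-monoʳ I (proj₁ basisJ) (C⊆I∪J x∈C)
      C⊆J : C ⊆ J
      C⊆J {x} x∈C = [ (λ x∈I → ⊥-elim (indMod C C⊆I∪T nullC x x∈I x∈C)) , id ]′ (x∈p∪q⁻ I J (C⊆I∪J x∈C))

-- Cycle spaces of contractions

record Chart (T : Subset n) (p : ℕ) : Set where
  field
    index         : Fin n → Fin p
    element       : Fin p → Fin n
    element∉      : ∀ i → element i ∉ T
    index-element : ∀ i → index (element i) ≡ i
    element-index : ∀ x → x ∉ T → element (index x) ≡ x
open Chart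

pull : {T : Subset n} → Chart T p → Subset n → Subset p
pull χ I = tabulate (lookup I ∘ element χ)

module _ {T : Subset n} (χ : Chart T p) {I : Subset n} {i : Fin p} where

  ∈-pull⁻ : i ∈ pull χ I → element χ i ∈ I
  ∈-pull⁻ i∈ = lookup⇒∈ (trans (sym (lookup∘tabulate (lookup I ∘ element χ) i)) (∈⇒lookup i∈))

  ∈-pull⁺ : element χ i ∈ I → i ∈ pull χ I
  ∈-pull⁺ el∈ = lookup⇒∈ (trans (lookup∘tabulate (lookup I ∘ element χ) i) (∈⇒lookup el∈))

Restricts : {T : Subset n} → Chart T p → Subset n → Subset p → Set
Restricts {T = T} χ C c = ∀ x → x ∉ T → lookup C x ≡ lookup c (index χ x)

-- The cycle space of M[ A ] ／ T, transported along χ.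
Trace : {T : Subset n} → Matrix m n → Chart T p → Subset p → Set
Trace A χ c = Σ (Subset _) λ C → Null A C × Restricts χ C c

Independent : (Subset p → Set) → Subset p → Set
Independent W c = ∀ c′ → c′ ⊆ c → W c′ → ∀ i → i ∉ c′

Independent-cong : {W W′ : Subset p → Set} → (∀ c → W c ⇔ W′ c) → ∀ c → Independent W c ⇔ Independent W′ c
Independent-cong W⇔W′ c = mk⇔ (λ ind c′ c′⊆c → ind c′ c′⊆c ∘ Equivalence.from (W⇔W′ c′))
                              (λ ind c′ c′⊆c → ind c′ c′⊆c ∘ Equivalence.to (W⇔W′ c′))

indepModulo⇔Independent : (A : Matrix m n) {T : Subset n} (χ : Chart T p) {I : Subset n} → I ⊆ ⊤ ─ T
  → IndepModulo A T I ⇔ Independent (Trace A χ) (pull χ I)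
indepModulo⇔Independent A {T} χ {I} I⊆E = mk⇔ to from
  where
  to : IndepModulo A T I → Independent (Trace A χ) (pull χ I)
  to indMod c′ c′⊆I (C , nullC , agree) i i∈c′ = indMod C C⊆I∪T nullC (element χ i) (∈-pull⁻ χ (c′⊆I i∈c′)) el∈C
    where
    el∈C : element χ i ∈ C
    el∈C = lookup⇒∈ (trans (agree _ (element∉ χ i))
             (trans (cong (lookup c′) (index-element χ i)) (∈⇒lookup i∈c′)))
    C⊆I∪T : C ⊆ I ∪ T
    C⊆I∪T {x} x∈C with x ∈? T
    ... | yes x∈T = q⊆p∪q I T x∈T
    ... | no  x∉T = p⊆p∪q T (subst (_∈ I) (element-index χ x x∉T) (∈-pull⁻ χ (c′⊆I ix∈c′)))
      where
      ix∈c′ : index χ x ∈ c′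
      ix∈c′ = lookup⇒∈ (trans (sym (agree x x∉T)) (∈⇒lookup x∈C))
  from : Independent (Trace A χ) (pull χ I) → IndepModulo A T I
  from ind C C⊆I∪T nullC j j∈I j∈C = ind (pull χ C) pullC⊆pullI (C , nullC , agree) (index χ j) ij∈pullC
    where
    j∉T : j ∉ T
    j∉T = ∈─⇒∉ ⊤ T (I⊆E j∈I)
    pullC⊆pullI : pull χ C ⊆ pull χ I
    pullC⊆pullI {i} i∈ =
      ∈-pull⁺ χ ([ id , (λ el∈T → ⊥-elim (element∉ χ i el∈T)) ]′ (x∈p∪q⁻ I T (C⊆I∪T (∈-pull⁻ χ i∈))))
    agree : Restricts χ C (pull χ C)
    agree x x∉T = sym (trans (lookup∘tabulate (lookup C ∘ element χ) (index χ x)) (cong (lookup C) (element-index χ x x∉T)))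
    ij∈pullC : index χ j ∈ pull χ C
    ij∈pullC = ∈-pull⁺ χ (subst (_∈ C) (sym (element-index χ j j∉T)) j∈C)

indep-／⇔Independent : (A : Matrix m n) {T : Subset n} (χ : Chart T p) {I : Subset n} → I ⊆ ⊤ ─ T
  → Indep (M[ A ] ／ T) I ⇔ Independent (Trace A χ) (pull χ I)
indep-／⇔Independent A {T} χ {I} I⊆E =
  indepModulo⇔Independent A χ I⊆E ⇔-∘ (forget-⊆ ⇔-∘ indep-／⇔ A T I)
  where
  forget-⊆ : (I ⊆ ⊤ ─ T × IndepModulo A T I) ⇔ IndepModulo A T I
  forget-⊆ = mk⇔ proj₂ (λ indMod → (λ {x} → I⊆E {x}) , indMod)

⇔⇒lookup≡ : {n′ : ℕ} {p : Subset n} {q : Subset n′} {x : Fin n} {y : Fin n′}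
  → (x ∈ p ⇔ y ∈ q) → lookup p x ≡ lookup q y
⇔⇒lookup≡ {p = p} {q} {x} {y} x∈⇔y∈ with lookup p x in eqp | lookup q y in eqq
... | true  | true  = refl
... | false | false = refl
... | true  | false = ⊥-elim (lookup⇒∉ eqq (Equivalence.to x∈⇔y∈ (lookup⇒∈ eqp)))
... | false | true  = ⊥-elim (lookup⇒∉ eqp (Equivalence.from x∈⇔y∈ (lookup⇒∈ eqq)))

≅-fromTraces : {m′ n′ : ℕ} (A : Matrix m n) {T : Subset n} (χ : Chart T p)
  (A′ : Matrix m′ n′) {T′ : Subset n′} (χ′ : Chart T′ p)
  → (∀ c → Trace A χ c ⇔ Trace A′ χ′ c) → (M[ A ] ／ T) ≅ (M[ A′ ] ／ T′)
≅-fromTraces {n = n} {n′ = n′} A {T} χ A′ {T′} χ′ sameTraces =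
  f , g , (λ x _ → inE′ (index χ x)) , (λ y _ → inE (index χ′ y)) ,
  (λ x x∈E → trans (cong (element χ) (index-element χ′ (index χ x))) (element-index χ x (∈─⇒∉ ⊤ T x∈E))) ,
  (λ y y∈E′ → trans (cong (element χ′) (index-element χ (index χ′ y))) (element-index χ′ y (∈─⇒∉ ⊤ T′ y∈E′))) ,
  indep
  where
  f : Fin n → Fin n′
  f = element χ′ ∘ index χ
  g : Fin n′ → Fin n
  g = element χ ∘ index χ′
  inE : ∀ i → element χ i ∈ ⊤ ─ T
  inE i = x∈p∧x∉q⇒x∈p─q ∈⊤ (element∉ χ i)
  inE′ : ∀ i → element χ′ i ∈ ⊤ ─ T′
  inE′ i = x∈p∧x∉q⇒x∈p─q ∈⊤ (element∉ χ′ i)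
  indep : ∀ I J → I ⊆ ⊤ ─ T → J ⊆ ⊤ ─ T′ → (∀ x → x ∈ ⊤ ─ T → (x ∈ I ⇔ f x ∈ J))
        → Indep (M[ A ] ／ T) I ⇔ Indep (M[ A′ ] ／ T′) J
  indep I J I⊆E J⊆E′ corr = begin
    Indep (M[ A ] ／ T) I                        ≈⟨ indep-／⇔Independent A χ I⊆E ⟩
    Independent (Trace A χ) (pull χ I)           ≡⟨ cong (Independent (Trace A χ)) samePull ⟩
    Independent (Trace A χ) (pull χ′ J)          ≈⟨ Independent-cong sameTraces (pull χ′ J) ⟩
    Independent (Trace A′ χ′) (pull χ′ J)        ≈⟨ ⇔-sym (indep-／⇔Independent A′ χ′ J⊆E′) ⟩
    Indep (M[ A′ ] ／ T′) J                      ∎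
    where
    open SetoidReasoning (⇔-setoid 0ℓ)
    samePull : pull χ I ≡ pull χ′ J
    samePull = tabulate-cong λ i →
      trans (⇔⇒lookup≡ (corr (element χ i) (inE i))) (cong (lookup J ∘ element χ′) (index-element χ i))

≅⇒Chart : {A : Matrix m n} {T : Subset n} {N : Matroid} → (M[ A ] ／ T) ≅ N → (∀ y → y ∈ E N) → Chart T (size N)
≅⇒Chart {T = T} (f , g , _ , g∈E , gf , fg , _) all∈E = record
  { index         = f
  ; element       = g
  ; element∉      = λ i → ∈─⇒∉ ⊤ T (g∈E i (all∈E i))
  ; index-element = λ i → fg i (all∈E i)
  ; element-index = λ x x∉T → gf x (x∈p∧x∉q⇒x∈p─q ∈⊤ x∉T)
  }

push : {T : Subset n} → Chart T p → Subset p → Subset n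
push {T = T} χ c = tabulate (λ x → not (lookup T x) ∧ lookup c (index χ x))

module _ {T : Subset n} (χ : Chart T p) (c : Subset p) where

  lookup-push : ∀ x → x ∉ T → lookup (push χ c) x ≡ lookup c (index χ x)
  lookup-push x x∉T = trans (lookup∘tabulate _ x) (cong (λ b → not b ∧ lookup c (index χ x)) (∉⇒lookup x∉T))

  push⊆ : push χ c ⊆ ⊤ ─ T
  push⊆ {x} x∈ = x∈p∧x∉q⇒x∈p─q ∈⊤ λ x∈T →
    lookup⇒∉ (trans (lookup∘tabulate _ x) (cong (λ b → not b ∧ lookup c (index χ x)) (∈⇒lookup x∈T))) x∈

  pull-push : pull χ (push χ c) ≡ c
  pull-push = trans (tabulate-cong λ i → trans (lookup-push (element χ i) (element∉ χ i)) (cong (lookup c) (index-element χ i)))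
                    (tabulate∘lookup c)

≅-Independent : {A : Matrix m n} {T : Subset n} {N : Matroid} (iso : (M[ A ] ／ T) ≅ N) (all∈E : ∀ y → y ∈ E N)
  → ∀ c → Independent (Trace A (≅⇒Chart iso all∈E)) c ⇔ Indep N c
≅-Independent {A = A} {T} {N} iso@(_ , _ , _ , _ , _ , _ , indep) all∈E c =
  indep (push χ c) c (push⊆ χ c) (λ {y} _ → all∈E y) corr
    ⇔-∘ subst (λ c′ → Independent (Trace A χ) c′ ⇔ Indep (M[ A ] ／ T) (push χ c)) (pull-push χ c)
              (⇔-sym (indep-／⇔Independent A χ (push⊆ χ c)))
  where
  χ : Chart T (size N)
  χ = ≅⇒Chart iso all∈E
  corr : ∀ x → x ∈ ⊤ ─ T → (x ∈ push χ c ⇔ index χ x ∈ c)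
  corr x x∈E = mk⇔ (λ x∈ → lookup⇒∈ (trans (sym (lookup-push χ c x x∉T)) (∈⇒lookup x∈)))
                   (λ ix∈ → lookup⇒∈ (trans (lookup-push χ c x x∉T) (∈⇒lookup ix∈)))
    where
    x∉T : x ∉ T
    x∉T = ∈─⇒∉ ⊤ T x∈E

indep-／⊥⇔ : (A : Matrix m n) (I : Subset n) → Indep (M[ A ] ／ ⊥) I ⇔ Indep M[ A ] I
indep-／⊥⇔ A I =
  modulo⊥ ⇔-∘ (mk⇔ proj₂ (λ indMod → (λ {x} _ → x∈p∧x∉q⇒x∈p─q ∈⊤ ∉⊥) , indMod) ⇔-∘ indep-／⇔ A ⊥ I)
  where
  modulo⊥ : IndepModulo A ⊥ I ⇔ Indep M[ A ] I
  modulo⊥ = mk⇔ (λ indMod C C⊆I nullC j j∈C → indMod C (p⊆p∪q ⊥ ∘ C⊆I) nullC j (C⊆I j∈C) j∈C)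
                (λ indI C C⊆I∪⊥ nullC j _ → indI C ([ id , ⊥-elim ∘ ∉⊥ ]′ ∘ x∈p∪q⁻ I ⊥ ∘ C⊆I∪⊥) nullC j)

≅-／⊥ : {A : Matrix m n} {N : Matroid} → M[ A ] ≅ N → (M[ A ] ／ ⊥) ≅ N
≅-／⊥ {A = A} (f , g , f∈E , g∈E , gf , fg , indep) =
  f , g , (λ x _ → f∈E x ∈⊤) , (λ y y∈E → x∈p∧x∉q⇒x∈p─q ∈⊤ ∉⊥) , (λ x _ → gf x ∈⊤) , fg ,
  λ I J _ J⊆E corr →
    indep I J (λ _ → ∈⊤) J⊆E (λ x _ → corr x (x∈p∧x∉q⇒x∈p─q ∈⊤ ∉⊥)) ⇔-∘ indep-／⊥⇔ A I

-- Appending a row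

parity : (Fin n → Bool) → Subset n → Bool
parity r C = xorSum (λ j → lookup C j ∧ r j)

parity-⊕ : (r : Fin n → Bool) (p q : Subset n) → parity r (p ⊕ q) ≡ parity r p xor parity r q
parity-⊕ r p q = colSum-⊕ (λ (_ : Fin 1) → r) p q zero

null-appendRow : (A : Matrix m n) (r : Fin n → Bool) (C : Subset n)
  → Null (appendRow A r) C ⇔ (Null A C × parity r C ≡ false)
null-appendRow {zero}  A r C = mk⇔ (λ null → (λ ()) , null zero) (λ { (_ , even) zero → even })
null-appendRow {suc m} A r C = mk⇔
  (λ null → let (nullA , even) = Equivalence.to ih (null ∘ suc) in (λ { zero → null zero ; (suc i) → nullA i }) , even)
  (λ { (nullA , even) → λ { zero → nullA zero ; (suc i) → Equivalence.from ih ((nullA ∘ suc) , even) i } })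
  where
  ih : Null (appendRow (A ∘ suc) r) C ⇔ (Null (A ∘ suc) C × parity r C ≡ false)
  ih = null-appendRow (A ∘ suc) r C

module ParityTraces (A : Matrix m n) (r : Fin n → Bool) {T : Subset n} (χ : Chart T p) where

  TraceWith : Subset p → Bool → Set
  TraceWith c s = Σ (Subset n) λ C → Null A C × parity r C ≡ s × Restricts χ C c

  traceWith? : ∀ s → Decidable (λ c → TraceWith c s)
  traceWith? s c = anySubset? λ C → null? A C ×-dec (parity r C ≟ᵇ s) ×-dec
                     all? (λ x → ¬? (x ∈? T) →-dec (lookup C x ≟ᵇ lookup c (index χ x)))

  traceWith-⊥ : TraceWith ⊥ false
  traceWith-⊥ = ⊥ , null-⊥ A , null-⊥ (λ (_ : Fin 1) → r) zero
                  , λ x _ → trans (lookup-replicate x false) (sym (lookup-replicate (index χ x) false))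

  traceWith-⊕ : ∀ {c c′ s s′} → TraceWith c s → TraceWith c′ s′ → TraceWith (c ⊕ c′) (s xor s′)
  traceWith-⊕ {c} {c′} (C , nullC , parC , agreeC) (C′ , nullC′ , parC′ , agreeC′) =
    C ⊕ C′ , null-⊕ A {C} {C′} nullC nullC′ , trans (parity-⊕ r C C′) (cong₂ _xor_ parC parC′) ,
    λ x x∉T → trans (lookup-⊕ C C′ x)
                (trans (cong₂ _xor_ (agreeC x x∉T) (agreeC′ x x∉T)) (sym (lookup-⊕ c c′ (index χ x))))

  trace-appendRow : ∀ c → Trace (appendRow A r) χ c ⇔ TraceWith c false
  trace-appendRow c = mk⇔
    (λ (C , null , agree) → let (nullA , even) = Equivalence.to (null-appendRow A r C) null in C , nullA , even , agree)
    (λ (C , nullA , even , agree) → C , Equivalence.from (null-appendRow A r C) (nullA , even) , agree)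

  trace⇔traceWith : ∀ c → Trace A χ c ⇔ (TraceWith c false ⊎ TraceWith c true)
  trace⇔traceWith c = mk⇔ to from
    where
    to : Trace A χ c → TraceWith c false ⊎ TraceWith c true
    to (C , null , agree) with parity r C in par
    ... | false = inj₁ (C , null , par , agree)
    ... | true  = inj₂ (C , null , par , agree)
    from : TraceWith c false ⊎ TraceWith c true → Trace A χ c
    from (inj₁ (C , null , _ , agree)) = C , null , agree
    from (inj₂ (C , null , _ , agree)) = C , null , agree

  traceWith-shift : ∀ {c c₀} → TraceWith c₀ true → TraceWith c true ⇔ TraceWith (c ⊕ c₀) false
  traceWith-shift {c} {c₀} t₀ = mk⇔ (λ t → traceWith-⊕ {c} {c₀} t t₀)
    (λ t → subst (λ c′ → TraceWith c′ true) (⊕-cancelʳ c c₀) (traceWith-⊕ {c ⊕ c₀} {c₀} t t₀))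

  trace-classification : {k : ℕ} (R : Matrix k p) → (∀ c → TraceWith c false ⇔ Null R c)
    → Σ (Vec Bool k) λ d → ∀ c → Trace A χ c ⇔ (Null R c ⊎ (∀ i → colSum R c i ≡ lookup d i))
  trace-classification {k} R even⇔null with anySubset? (traceWith? true)
  ... | yes (c₀ , t₀) = d , λ c → (even⇔null c ⊎-⇔ odd⇔ c) ⇔-∘ trace⇔traceWith c
    where
    d : Vec Bool k
    d = tabulate (colSum R c₀)
    null⊕⇔ : ∀ c → Null R (c ⊕ c₀) ⇔ (∀ i → colSum R c i ≡ lookup d i)
    null⊕⇔ c = mk⇔
      (λ null i → trans (xor≡false⇒≡ (trans (sym (colSum-⊕ R c c₀ i)) (null i))) (sym (lookup∘tabulate _ i)))
      (λ eq i → trans (colSum-⊕ R c c₀ i) (≡⇒xor≡false (trans (eq i) (lookup∘tabulate _ i))))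
    odd⇔ : ∀ c → TraceWith c true ⇔ (∀ i → colSum R c i ≡ lookup d i)
    odd⇔ c = null⊕⇔ c ⇔-∘ (even⇔null (c ⊕ c₀) ⇔-∘ traceWith-shift {c} {c₀} t₀)
  ... | no noOdd = replicate _ false , λ c → mk⇔
    (λ tr → inj₁ (Equivalence.to (even⇔null c)
                    ([ id , (λ t → ⊥-elim (noOdd (c , t))) ]′ (Equivalence.to (trace⇔traceWith c) tr))))
    (λ null⊎ → Equivalence.from (trace⇔traceWith c) (inj₁ (Equivalence.from (even⇔null c) (null-of {c} null⊎))))
    where
    null-of : ∀ {c} → Null R c ⊎ (∀ i → colSum R c i ≡ lookup (replicate _ false) i) → Null R c
    null-of (inj₁ null) = null
    null-of (inj₂ eq) i = trans (eq i) (lookup-replicate i false)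

-- Prepending a column

_∷ᶜ_ : Vec Bool m → Matrix m p → Matrix m (suc p)
(d ∷ᶜ R) i zero    = lookup d i
(d ∷ᶜ R) i (suc j) = R i j

-- The index of the contracted element zero is arbitrary.
dropFirst : Chart {suc (suc p)} ⁅ zero ⁆ (suc p)
dropFirst = record
  { index         = λ { zero → zero ; (suc i) → i }
  ; element       = suc
  ; element∉      = λ _ → ∉⊥ ∘ drop-there
  ; index-element = λ _ → refl
  ; element-index = λ { zero 0∉ → ⊥-elim (0∉ (x∈⁅x⁆ zero)) ; (suc i) _ → refl }
  }

trace-∷ᶜ : (d : Vec Bool m) (R : Matrix m (suc p)) (c : Subset (suc p))
  → Trace (d ∷ᶜ R) dropFirst c ⇔ (Null R c ⊎ (∀ i → colSum R c i ≡ lookup d i))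
trace-∷ᶜ d R c = mk⇔ to from
  where
  agree : ∀ s → Restricts dropFirst (s ∷ c) c
  agree s zero    0∉ = ⊥-elim (0∉ (x∈⁅x⁆ zero))
  agree s (suc i) _  = refl
  to : Trace (d ∷ᶜ R) dropFirst c → Null R c ⊎ (∀ i → colSum R c i ≡ lookup d i)
  to (s ∷ C , null , agreeC) with lookup-ext {p = C} {c} (λ i → agreeC (suc i) (∉⊥ ∘ drop-there))
  to (false ∷ C , null , _) | refl = inj₁ null
  to (true  ∷ C , null , _) | refl = inj₂ λ i → sym (xor≡false⇒≡ (null i))
  from : Null R c ⊎ (∀ i → colSum R c i ≡ lookup d i) → Trace (d ∷ᶜ R) dropFirst c
  from (inj₁ null) = false ∷ c , null , agree false
  from (inj₂ eq)   = true ∷ c , (λ i → ≡⇒xor≡false (sym (eq i))) , agree true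

indep-∷ᶜ⇔ : (d : Vec Bool m) (R : Matrix m p) (J : Subset p) → Indep M[ d ∷ᶜ R ] (false ∷ J) ⇔ Indep M[ R ] J
indep-∷ᶜ⇔ d R J = mk⇔
  (λ indep C C⊆J null j j∈C → indep (false ∷ C) (λ { (there x∈) → there (C⊆J x∈) }) null (suc j) (there j∈C))
  λ { indep (true ∷ C) C⊆ null j j∈C → case C⊆ here of λ ()
    ; indep (false ∷ C) C⊆ null (suc j) (there j∈C) → indep C (drop-there ∘ C⊆ ∘ there) null j j∈C }

∖first≅ : (d : Vec Bool m) (R : Matrix m (suc p)) (P : Subset (suc p) → Set) → (∀ c → P c ⇔ Indep M[ R ] c)
  → (M[ d ∷ᶜ R ] ∖ ⁅ zero ⁆) ≅ record { size = suc p ; E = ⊤ ; Indep = P }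
∖first≅ d R P P⇔ =
  index dropFirst , suc , (λ _ _ → ∈⊤) , (λ y _ → x∈p∧x∉q⇒x∈p─q ∈⊤ (element∉ dropFirst y)) ,
  (λ x x∈E → element-index dropFirst x (∈─⇒∉ ⊤ ⁅ zero ⁆ x∈E)) , (λ _ _ → refl) , indep
  where
  indep : ∀ I J → I ⊆ ⊤ ─ ⁅ zero ⁆ → J ⊆ ⊤
        → (∀ x → x ∈ ⊤ ─ ⁅ zero ⁆ → (x ∈ I ⇔ index dropFirst x ∈ J))
        → Indep (M[ d ∷ᶜ R ] ∖ ⁅ zero ⁆) I ⇔ P J
  indep I J I⊆E _ corr = ⇔-sym (P⇔ J) ⇔-∘
    (subst (λ I′ → Indep M[ d ∷ᶜ R ] I′ ⇔ Indep M[ R ] J) (sym I≡) (indep-∷ᶜ⇔ d R J) ⇔-∘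
      mk⇔ proj₂ (λ indep → (λ {x} → I⊆E {x}) , indep))
    where
    I≡ : I ≡ false ∷ J
    I≡ = lookup-ext λ
      { zero    → ∉⇒lookup (λ 0∈ → ∈─⇒∉ ⊤ ⁅ zero ⁆ (I⊆E 0∈) (x∈⁅x⁆ zero))
      ; (suc i) → ⇔⇒lookup≡ (corr (suc i) (x∈p∧x∉q⇒x∈p─q ∈⊤ (element∉ dropFirst i))) }

-- The graph F

joins? : (G : Graph) → ∀ e a b → Dec (Joins G e a b)
joins? G e a b = ≡-dec _≟_ _≟_ (ends G e) (a , b) ⊎-dec ≡-dec _≟_ _≟_ (ends G e) (b , a)

cycle-mono : {G : Graph} {I J : Subset (nEdge G)} → I ⊆ J → CycleIn G I → CycleIn G J
cycle-mono I⊆J cyc = record { CycleIn cyc ; inI = I⊆J ∘ CycleIn.inI cyc }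

module _ (G : Graph) (I : Subset (nEdge G)) (k : ℕ)
         (cv : Fin (suc (suc k)) → Fin (nVert G)) (ce : Fin (suc k) → Fin (nEdge G)) where

  IsCycle : Set
  IsCycle = cv (fromℕ (suc k)) ≡ cv zero
          × (∀ i → Joins G (ce i) (cv (inject₁ i)) (cv (suc i)))
          × (∀ i → ce i ∈ I)
          × (∀ i j → cv (inject₁ i) ≡ cv (inject₁ j) → i ≡ j)
          × (∀ i j → ce i ≡ ce j → i ≡ j)

  isCycle? : Dec IsCycle
  isCycle? = cv (fromℕ (suc k)) ≟ cv zero
       ×-dec all? (λ i → joins? G (ce i) (cv (inject₁ i)) (cv (suc i)))
       ×-dec all? (λ i → ce i ∈? I)
       ×-dec all? (λ i → all? λ j → cv (inject₁ i) ≟ cv (inject₁ j) →-dec i ≟ j)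
       ×-dec all? (λ i → all? λ j → ce i ≟ ce j →-dec i ≟ j)

  cycle : True isCycle? → CycleIn G I
  cycle ok = let (closed , joins , inI , cvInj , ceInj) = toWitness ok in record
    { k = suc k ; k≥1 = s≤s z≤n ; cv = cv ; closed = closed ; ce = ce
    ; joins = joins ; inI = inI ; cvInj = cvInj ; ceInj = ceInj }

Parallel : (G : Graph) → Fin (nEdge G) → Fin (nEdge G) → Set
Parallel G e e′ = ends G e ≡ ends G e′ ⊎ ends G e ≡ swap (ends G e′)

parallel? : (G : Graph) → ∀ e e′ → Dec (Parallel G e e′)
parallel? G e e′ = ≡-dec _≟_ _≟_ (ends G e) (ends G e′) ⊎-dec ≡-dec _≟_ _≟_ (ends G e) (swap (ends G e′))

parallel-sym : (G : Graph) {e e′ : Fin (nEdge G)} → Parallel G e e′ → Parallel G e′ e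
parallel-sym G (inj₁ eq) = inj₁ (sym eq)
parallel-sym G (inj₂ eq) = inj₂ (trans (sym (cong swap eq)) (swap-involutive _))

joins⇒parallel : (G : Graph) {e e′ : Fin (nEdge G)} {a b : Fin (nVert G)}
  → Joins G e a b → Joins G e′ b a → Parallel G e e′
joins⇒parallel G (inj₁ e≡ab) (inj₁ e′≡ba) = inj₂ (trans e≡ab (sym (cong swap e′≡ba)))
joins⇒parallel G (inj₁ e≡ab) (inj₂ e′≡ab) = inj₁ (trans e≡ab (sym e′≡ab))
joins⇒parallel G (inj₂ e≡ba) (inj₁ e′≡ba) = inj₁ (trans e≡ba (sym e′≡ba))
joins⇒parallel G (inj₂ e≡ba) (inj₂ e′≡ab) = inj₂ (trans e≡ba (sym (cong swap e′≡ab)))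

no-cycle-in-pair : (G : Graph) → (∀ e a → ¬ Joins G e a a)
  → ∀ e e′ → ¬ Parallel G e e′ → ¬ CycleIn G (⁅ e ⁆ ∪ ⁅ e′ ⁆)
no-cycle-in-pair G loopless e e′ ¬par cyc = impossible k k≥1 cv closed ce joins inI ceInj
  where
  open CycleIn cyc
  member : ∀ {x} → x ∈ ⁅ e ⁆ ∪ ⁅ e′ ⁆ → x ≡ e ⊎ x ≡ e′
  member x∈ = Sum.map (x∈⁅y⁆⇒x≡y e) (x∈⁅y⁆⇒x≡y e′) (x∈p∪q⁻ ⁅ e ⁆ ⁅ e′ ⁆ x∈)
  distinct-parallel : ∀ {x y} → x ≡ e ⊎ x ≡ e′ → y ≡ e ⊎ y ≡ e′ → x ≢ y → ¬ Parallel G x y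
  distinct-parallel (inj₁ refl) (inj₁ refl) x≢y _   = x≢y refl
  distinct-parallel (inj₂ refl) (inj₂ refl) x≢y _   = x≢y refl
  distinct-parallel (inj₁ refl) (inj₂ refl) _   par = ¬par par
  distinct-parallel (inj₂ refl) (inj₁ refl) _   par = ¬par (parallel-sym G par)
  pigeonhole : ∀ {x y z} → x ≡ e ⊎ x ≡ e′ → y ≡ e ⊎ y ≡ e′ → z ≡ e ⊎ z ≡ e′ → x ≡ y ⊎ x ≡ z ⊎ y ≡ z
  pigeonhole (inj₁ refl) (inj₁ refl) _           = inj₁ refl
  pigeonhole (inj₂ refl) (inj₂ refl) _           = inj₁ refl
  pigeonhole (inj₁ refl) (inj₂ refl) (inj₁ refl) = inj₂ (inj₁ refl)
  pigeonhole (inj₁ refl) (inj₂ refl) (inj₂ refl) = inj₂ (inj₂ refl)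
  pigeonhole (inj₂ refl) (inj₁ refl) (inj₁ refl) = inj₂ (inj₂ refl)
  pigeonhole (inj₂ refl) (inj₁ refl) (inj₂ refl) = inj₂ (inj₁ refl)
  impossible : ∀ k → 1 ≤ k → (cv : Fin (suc k) → Fin (nVert G)) → cv (fromℕ k) ≡ cv zero
    → (ce : Fin k → Fin (nEdge G)) → (∀ i → Joins G (ce i) (cv (inject₁ i)) (cv (suc i)))
    → (∀ i → ce i ∈ ⁅ e ⁆ ∪ ⁅ e′ ⁆) → (∀ i j → ce i ≡ ce j → i ≡ j) → Data.Empty.⊥
  impossible 1 _ cv closed ce joins _ _ =
    loopless (ce zero) (cv zero) (subst (Joins G (ce zero) (cv zero)) closed (joins zero))
  impossible 2 _ cv closed ce joins inI ceInj =
    distinct-parallel (member (inI zero)) (member (inI (suc zero))) (λ eq → case ceInj _ _ eq of λ ())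
      (joins⇒parallel G (joins zero) (subst (Joins G (ce (suc zero)) (cv (suc zero))) closed (joins (suc zero))))
  impossible (suc (suc (suc k))) _ cv closed ce joins inI ceInj
    with pigeonhole (member (inI zero)) (member (inI (suc zero))) (member (inI (suc (suc zero))))
  ... | inj₁ eq        = case ceInj _ _ eq of λ ()
  ... | inj₂ (inj₁ eq) = case ceInj _ _ eq of λ ()
  ... | inj₂ (inj₂ eq) = case ceInj _ _ eq of λ ()

-- The incidence matrix of F (rows v and w; the row of u is their sum and is dropped).
Frep : Matrix 2 5
Frep i e = lookup (lookup rows i) e
  where
  rows : Vec (Vec Bool 5) 2
  rows = (true  ∷ true  ∷ false ∷ false ∷ true ∷ [])
       ∷ (false ∷ false ∷ true  ∷ true  ∷ true ∷ [])
       ∷ []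

-- The first three are the fundamental circuits of the spanning tree {e₀, e₂}.
circuit : Fin 6 → Subset 5
circuit i = lookup circuits i
  where
  circuits : Vec (Subset 5) 6
  circuits = (true  ∷ true  ∷ false ∷ false ∷ false ∷ [])
           ∷ (false ∷ false ∷ true  ∷ true  ∷ false ∷ [])
           ∷ (true  ∷ false ∷ true  ∷ false ∷ true  ∷ [])
           ∷ (true  ∷ false ∷ false ∷ true  ∷ true  ∷ [])
           ∷ (false ∷ true  ∷ true  ∷ false ∷ true  ∷ [])
           ∷ (false ∷ true  ∷ false ∷ true  ∷ true  ∷ [])
           ∷ []

private
  u v w : Fin 3
  u = zero
  v = suc zero
  w = suc (suc zero)

  e₀ e₁ e₂ e₃ e₄ : Fin 5
  e₀ = zero
  e₁ = suc zero
  e₂ = suc (suc zero)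
  e₃ = suc (suc (suc zero))
  e₄ = suc (suc (suc (suc zero)))

circuit-cycle : ∀ i → CycleIn F (circuit i)
circuit-cycle zero = cycle F _ 1 (lookup (u ∷ v ∷ u ∷ [])) (lookup (e₀ ∷ e₁ ∷ [])) _
circuit-cycle (suc zero) = cycle F _ 1 (lookup (u ∷ w ∷ u ∷ [])) (lookup (e₂ ∷ e₃ ∷ [])) _
circuit-cycle (suc (suc zero)) = cycle F _ 2 (lookup (u ∷ v ∷ w ∷ u ∷ [])) (lookup (e₀ ∷ e₄ ∷ e₂ ∷ [])) _
circuit-cycle (suc (suc (suc zero))) = cycle F _ 2 (lookup (u ∷ v ∷ w ∷ u ∷ [])) (lookup (e₀ ∷ e₄ ∷ e₃ ∷ [])) _
circuit-cycle (suc (suc (suc (suc zero)))) = cycle F _ 2 (lookup (u ∷ v ∷ w ∷ u ∷ [])) (lookup (e₁ ∷ e₄ ∷ e₂ ∷ [])) _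
circuit-cycle (suc (suc (suc (suc (suc zero))))) = cycle F _ 2 (lookup (u ∷ v ∷ w ∷ u ∷ [])) (lookup (e₁ ∷ e₄ ∷ e₃ ∷ [])) _

Acyclic : Subset 5 → Set
Acyclic c = ∀ i → ¬ circuit i ⊆ c

acyclic? : Decidable Acyclic
acyclic? c = all? (λ i → ¬? (circuit i ⊆? c))

F-loopless : ∀ e a → ¬ Joins F e a a
F-loopless = toWitness {a? = all? λ e → all? λ a → ¬? (joins? F e a a)} _

acyclic⇒⊆pair : ∀ c → Acyclic c → Σ (Fin 5) λ e → Σ (Fin 5) λ e′ → ¬ Parallel F e e′ × c ⊆ ⁅ e ⁆ ∪ ⁅ e′ ⁆
acyclic⇒⊆pair = toWitness {a? = allSubsets? λ c → acyclic? c →-dec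
  any? λ e → any? λ e′ → ¬? (parallel? F e e′) ×-dec c ⊆? ⁅ e ⁆ ∪ ⁅ e′ ⁆} _

acyclic⇔independent : ∀ c → Acyclic c ⇔ Indep M[ Frep ] c
acyclic⇔independent c = mk⇔ (proj₁ (check c)) (proj₂ (check c))
  where
  check : ∀ c → (Acyclic c → Indep M[ Frep ] c) × (Indep M[ Frep ] c → Acyclic c)
  check = toWitness {a? = allSubsets? λ c → (acyclic? c →-dec independent? Frep c) ×-dec (independent? Frep c →-dec acyclic? c)} _

F-represented : ∀ c → (¬ CycleIn F c) ⇔ Indep M[ Frep ] c
F-represented c = acyclic⇔independent c ⇔-∘ mk⇔
  (λ ¬cyc i circuit⊆c → ¬cyc (cycle-mono circuit⊆c (circuit-cycle i)))
  (λ acyclic cyc → let (e , e′ , ¬par , c⊆pair) = acyclic⇒⊆pair c acyclic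
                   in  no-cycle-in-pair F F-loopless e e′ ¬par (cycle-mono c⊆pair cyc))

infixr 7 _·_

_·_ : Bool → Subset n → Subset n
true  · c = c
false · c = ⊥

tree : Subset 5
tree = true ∷ false ∷ true ∷ false ∷ false ∷ []

fundamental : Subset 5 → Subset 5
fundamental c = lookup c e₁ · circuit zero ⊕ lookup c e₃ · circuit (suc zero) ⊕ lookup c e₄ · circuit (suc (suc zero))

⊕fundamental⊆tree : ∀ c → c ⊕ fundamental c ⊆ tree
⊕fundamental⊆tree = toWitness {a? = allSubsets? λ c → c ⊕ fundamental c ⊆? tree} _

subspace⇔≡fundamental : (U : Subset 5 → Set) → U ⊥ → (∀ {c c′} → U c → U c′ → U (c ⊕ c′))
  → (∀ i → U (circuit i)) → Independent U tree → ∀ c → U c ⇔ (c ≡ fundamental c)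
subspace⇔≡fundamental U U-⊥ U-⊕ U-circuit tree-indep c = mk⇔
  (λ Uc → empty-⊕⇒≡ (tree-indep (c ⊕ fundamental c) (⊕fundamental⊆tree c) (U-⊕ Uc (U-fundamental c))))
  (λ c≡ → subst U (sym c≡) (U-fundamental c))
  where
  U-· : ∀ b {c} → U c → U (b · c)
  U-· true  Uc = Uc
  U-· false _  = U-⊥
  U-fundamental : ∀ c → U (fundamental c)
  U-fundamental c = U-⊕ (U-· (lookup c e₁) (U-circuit zero))
                     (U-⊕ (U-· (lookup c e₃) (U-circuit (suc zero))) (U-· (lookup c e₄) (U-circuit (suc (suc zero)))))

cycleSpace⇔null : (W : Subset 5 → Set) → Decidable W → W ⊥ → (∀ {c c′} → W c → W c′ → W (c ⊕ c′))
  → (∀ c → Independent W c ⇔ Indep M[ Frep ] c) → ∀ c → W c ⇔ Null Frep c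
cycleSpace⇔null W W? W-⊥ W-⊕ sameIndep c =
  ⇔-sym (subspace⇔≡fundamental (Null Frep) (null-⊥ Frep) (λ {c} {c′} → null-⊕ Frep {c} {c′}) null-circuit tree-independent c)
    ⇔-∘ subspace⇔≡fundamental W W-⊥ W-⊕ W-circuit (Equivalence.from (sameIndep tree) tree-independent) c
  where
  null-circuit : ∀ i → Null Frep (circuit i)
  null-circuit = toWitness {a? = all? λ i → null? Frep (circuit i)} _
  tree-independent : Indep M[ Frep ] tree
  tree-independent = toWitness {a? = independent? Frep tree} _
  circuit-dependent : ∀ i → ¬ Indep M[ Frep ] (circuit i)
  circuit-dependent i indep = Equivalence.from (acyclic⇔independent (circuit i)) indep i id
  proper-acyclic : ∀ i c′ → c′ ⊆ circuit i → c′ ≡ circuit i ⊎ Acyclic c′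
  proper-acyclic = toWitness {a? = all? λ i → allSubsets? λ c′ → c′ ⊆? circuit i →-dec
    (≡-decᵛ _≟ᵇ_ c′ (circuit i) ⊎-dec acyclic? c′)} _
  -- A circuit is W-dependent while its proper subsets are not, so it lies in W itself.
  W-circuit : ∀ i → W (circuit i)
  W-circuit i with W? (circuit i)
  ... | yes Wcircuit = Wcircuit
  ... | no ¬Wcircuit = ⊥-elim (circuit-dependent i (Equivalence.to (sameIndep (circuit i)) independent))
    where
    independent : Independent W (circuit i)
    independent c′ c′⊆ Wc′ with proper-acyclic i c′ c′⊆
    ... | inj₁ refl    = ⊥-elim (¬Wcircuit Wc′)
    ... | inj₂ acyclic = Equivalence.from (sameIndep c′) (Equivalence.to (acyclic⇔independent c′) acyclic) c′ id Wc′

-- Binary matroids of rank at most two are gammoids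

three-nonzero-sum : ∀ a b c d e f → (a , b) ≢ (false , false) → (c , d) ≢ (false , false) → (e , f) ≢ (false , false)
  → (a , b) ≢ (c , d) → (a , b) ≢ (e , f) → (c , d) ≢ (e , f) → a xor c xor e ≡ false × b xor d xor f ≡ false
three-nonzero-sum = toWitness {a? = ∀-Bool? λ a → ∀-Bool? λ b → ∀-Bool? λ c → ∀-Bool? λ d → ∀-Bool? λ e → ∀-Bool? λ f →
  ≢? (a , b) (false , false) →-dec ≢? (c , d) (false , false) →-dec ≢? (e , f) (false , false) →-dec
  ≢? (a , b) (c , d) →-dec ≢? (a , b) (e , f) →-dec ≢? (c , d) (e , f) →-dec
  (a xor c xor e ≟ᵇ false ×-dec b xor d xor f ≟ᵇ false)} _
  where
  ≢? : (u v : Bool × Bool) → Dec (u ≢ v)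
  ≢? u v = ¬? (≡-dec _≟ᵇ_ _≟ᵇ_ u v)

module Rank2 (R : Matrix 2 n) where

  column : Fin n → Bool × Bool
  column x = R zero x , R (suc zero) x

  record Rank2Independent (I : Subset n) : Set where
    constructor rank2Independent
    field
      nonzero  : ∀ x → x ∈ I → column x ≢ (false , false)
      distinct : ∀ x y → x ∈ I → y ∈ I → x ≢ y → column x ≢ column y
      noThree  : ∀ x y z → x ∈ I → y ∈ I → z ∈ I → x ≢ y → x ≢ z → y ≢ z → Data.Empty.⊥

  private
    coordinates : ∀ {x u v} → column x ≡ (u , v) → ∀ i → R i x ≡ lookup (u ∷ v ∷ []) i
    coordinates col≡ zero       = cong proj₁ col≡
    coordinates col≡ (suc zero) = cong proj₂ col≡

    colSum-pair : ∀ x y i → colSum R (⁅ x ⁆ ⊕ ⁅ y ⁆) i ≡ R i x xor R i y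
    colSum-pair x y i = trans (colSum-⊕ R ⁅ x ⁆ ⁅ y ⁆ i) (cong₂ _xor_ (colSum-⁅⁆ R x i) (colSum-⁅⁆ R y i))

  indep⇒rank2Independent : ∀ {I} → Indep M[ R ] I → Rank2Independent I
  indep⇒rank2Independent {I} indep = rank2Independent nonzero distinct noThree
    where
    nonzero : ∀ x → x ∈ I → column x ≢ (false , false)
    nonzero x x∈ col≡ = indep ⁅ x ⁆ (λ y∈ → subst (_∈ I) (sym (x∈⁅y⁆⇒x≡y x y∈)) x∈)
      (λ i → trans (colSum-⁅⁆ R x i) (trans (coordinates col≡ i) (lookup-replicate i false))) x (x∈⁅x⁆ x)
    distinct : ∀ x y → x ∈ I → y ∈ I → x ≢ y → column x ≢ column y
    distinct x y x∈ y∈ x≢y col≡ = indep (⁅ x ⁆ ⊕ ⁅ y ⁆)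
      (λ z∈ → [ (λ { refl → x∈ }) , (λ { refl → y∈ }) ]′ (Equivalence.to (∈-pair x≢y) z∈))
      (λ i → trans (colSum-pair x y i) (≡⇒xor≡false (trans (coordinates col≡ i) (sym (coordinates refl i)))))
      x (Equivalence.from (∈-pair x≢y) (inj₁ refl))
    noThree : ∀ x y z → x ∈ I → y ∈ I → z ∈ I → x ≢ y → x ≢ z → y ≢ z → Data.Empty.⊥
    noThree x y z x∈ y∈ z∈ x≢y x≢z y≢z = indep (⁅ x ⁆ ⊕ ⁅ y ⁆ ⊕ ⁅ z ⁆) triple⊆I null x x∈triple
      where
      triple⊆I : ⁅ x ⁆ ⊕ ⁅ y ⁆ ⊕ ⁅ z ⁆ ⊆ I
      triple⊆I w∈ with ∈-⊕⁻ w∈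
      ... | inj₁ w∈x  = subst (_∈ I) (sym (x∈⁅y⁆⇒x≡y x w∈x)) x∈
      ... | inj₂ w∈yz = [ (λ { refl → y∈ }) , (λ { refl → z∈ }) ]′ (Equivalence.to (∈-pair y≢z) w∈yz)
      x∈triple : x ∈ ⁅ x ⁆ ⊕ ⁅ y ⁆ ⊕ ⁅ z ⁆
      x∈triple = ∈-⊕ˡ (x∈⁅x⁆ x) ([ x≢y , x≢z ]′ ∘ Equivalence.to (∈-pair y≢z))
      sums : (R zero x xor R zero y xor R zero z ≡ false) × (R (suc zero) x xor R (suc zero) y xor R (suc zero) z ≡ false)
      sums = three-nonzero-sum _ _ _ _ _ _ (nonzero x x∈) (nonzero y y∈) (nonzero z z∈)
               (distinct x y x∈ y∈ x≢y) (distinct x z x∈ z∈ x≢z) (distinct y z y∈ z∈ y≢z)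
      sum : ∀ i → R i x xor R i y xor R i z ≡ false
      sum zero       = proj₁ sums
      sum (suc zero) = proj₂ sums
      null : Null R (⁅ x ⁆ ⊕ ⁅ y ⁆ ⊕ ⁅ z ⁆)
      null i = trans (colSum-⊕ R ⁅ x ⁆ (⁅ y ⁆ ⊕ ⁅ z ⁆) i)
                     (trans (cong₂ _xor_ (colSum-⁅⁆ R x i) (colSum-pair y z i)) (sum i))

  rank2Independent⇒indep : ∀ {I} → Rank2Independent I → Indep M[ R ] I
  rank2Independent⇒indep (rank2Independent nonzero distinct noThree) C C⊆I null j j∈C with any? (λ y → y ∈? C ×-dec ¬? (y ≟ j))
  ... | no alone = nonzero j (C⊆I j∈C) (cong₂ _,_ (vanishes zero) (vanishes (suc zero)))
    where
    C≡⁅j⁆ : C ≡ ⁅ j ⁆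
    C≡⁅j⁆ = lookup-ext λ x → ⇔⇒lookup≡ (mk⇔
      (λ x∈C → case x ≟ j of λ { (yes refl) → x∈⁅x⁆ j ; (no x≢j) → ⊥-elim (alone (x , x∈C , x≢j)) })
      (λ x∈⁅j⁆ → subst (_∈ C) (sym (x∈⁅y⁆⇒x≡y j x∈⁅j⁆)) j∈C))
    vanishes : ∀ i → R i j ≡ false
    vanishes i = trans (sym (colSum-⁅⁆ R j i)) (trans (cong (λ C′ → colSum R C′ i) (sym C≡⁅j⁆)) (null i))
  ... | yes (y , y∈C , y≢j) = distinct j y (C⊆I j∈C) (C⊆I y∈C) (y≢j ∘ sym)
    (cong₂ _,_ (same zero) (same (suc zero)))
    where
    member : ∀ x → x ∈ C → x ≡ j ⊎ x ≡ y
    member x x∈C with x ≟ j | x ≟ y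
    ... | yes x≡j | _       = inj₁ x≡j
    ... | no _    | yes x≡y = inj₂ x≡y
    ... | no x≢j  | no x≢y  =
      ⊥-elim (noThree j y x (C⊆I j∈C) (C⊆I y∈C) (C⊆I x∈C) (y≢j ∘ sym) (x≢j ∘ sym) (x≢y ∘ sym))
    C≡pair : C ≡ ⁅ j ⁆ ⊕ ⁅ y ⁆
    C≡pair = lookup-ext λ x → ⇔⇒lookup≡
      (⇔-sym (∈-pair (y≢j ∘ sym)) ⇔-∘ mk⇔ (member x) λ { (inj₁ refl) → j∈C ; (inj₂ refl) → y∈C })
    same : ∀ i → R i j ≡ R i y
    same i = xor≡false⇒≡ (trans (sym (colSum-pair j y i)) (trans (cong (λ C′ → colSum R C′ i) (sym C≡pair)) (null i)))

  data Vertex : Set where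
    ground : Fin n → Vertex
    hub    : Bool × Bool → Vertex
    sink   : Fin 2 → Vertex

  Arc : Vertex → Vertex → Set
  Arc (ground _)    (ground _) = Data.Empty.⊥
  Arc (ground x)    (hub v)    = column x ≡ v
  Arc (ground _)    (sink _)   = Data.Empty.⊥
  Arc (hub _)       (ground _) = Data.Empty.⊥
  Arc (hub _)       (hub _)    = Data.Empty.⊥
  Arc (hub (a , b)) (sink i)   = lookup (a ∷ b ∷ []) i ≡ true
  Arc (sink _)      _          = Data.Empty.⊥

  arc? : ∀ s t → Dec (Arc s t)
  arc? (ground _)    (ground _) = no id
  arc? (ground x)    (hub v)    = ≡-dec _≟ᵇ_ _≟ᵇ_ (column x) v
  arc? (ground _)    (sink _)   = no id
  arc? (hub _)       (ground _) = no id
  arc? (hub _)       (hub _)    = no id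
  arc? (hub (a , b)) (sink i)   = lookup (a ∷ b ∷ []) i ≟ᵇ true
  arc? (sink _)      _          = no id

  isSink : Vertex → Bool
  isSink (sink _) = true
  isSink _        = false

  extra : Fin 6 → Vertex
  extra i = lookup (hub (false , false) ∷ hub (false , true) ∷ hub (true , false) ∷ hub (true , true)
                    ∷ sink zero ∷ sink (suc zero) ∷ []) i

  toSum : Vertex → Fin n ⊎ Fin 6
  toSum (ground x)            = inj₁ x
  toSum (hub (false , false)) = inj₂ zero
  toSum (hub (false , true))  = inj₂ (suc zero)
  toSum (hub (true , false))  = inj₂ (suc (suc zero))
  toSum (hub (true , true))   = inj₂ (suc (suc (suc zero)))
  toSum (sink zero)           = inj₂ (suc (suc (suc (suc zero))))
  toSum (sink (suc zero))     = inj₂ (suc (suc (suc (suc (suc zero)))))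

  fromSum : Fin n ⊎ Fin 6 → Vertex
  fromSum = [ ground , extra ]′

  fromSum-toSum : ∀ s → fromSum (toSum s) ≡ s
  fromSum-toSum (ground x)            = refl
  fromSum-toSum (hub (false , false)) = refl
  fromSum-toSum (hub (false , true))  = refl
  fromSum-toSum (hub (true , false))  = refl
  fromSum-toSum (hub (true , true))   = refl
  fromSum-toSum (sink zero)           = refl
  fromSum-toSum (sink (suc zero))     = refl

  toSum-fromSum : ∀ u → toSum (fromSum u) ≡ u
  toSum-fromSum (inj₁ x)                                   = refl
  toSum-fromSum (inj₂ zero)                                = refl
  toSum-fromSum (inj₂ (suc zero))                          = refl
  toSum-fromSum (inj₂ (suc (suc zero)))                    = refl
  toSum-fromSum (inj₂ (suc (suc (suc zero))))              = refl
  toSum-fromSum (inj₂ (suc (suc (suc (suc zero)))))        = refl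
  toSum-fromSum (inj₂ (suc (suc (suc (suc (suc zero)))))) = refl

  encode : Vertex → Fin (n + 6)
  encode = join n 6 ∘ toSum

  view : Fin (n + 6) → Vertex
  view = fromSum ∘ splitAt n

  view-encode : ∀ s → view (encode s) ≡ s
  view-encode s = trans (cong fromSum (splitAt-join n 6 (toSum s))) (fromSum-toSum s)

  encode-view : ∀ u → encode (view u) ≡ u
  encode-view u = trans (cong (join n 6) (toSum-fromSum (splitAt n u))) (join-splitAt n 6 u)

  encode-injective : ∀ {s t} → encode s ≡ encode t → s ≡ t
  encode-injective {s} {t} eq = trans (sym (view-encode s)) (trans (cong view eq) (view-encode t))

  digraph : Digraph
  digraph = record { nV = n + 6 ; arc = λ u u′ → does (arc? (view u) (view u′)) }

  sinks : Subset (n + 6)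
  sinks = tabulate (isSink ∘ view)

  private
    ground-injective : ∀ {x y} → ground x ≡ ground y → x ≡ y
    ground-injective refl = refl

    hub-injective : ∀ {v v′} → hub v ≡ hub v′ → v ≡ v′
    hub-injective refl = refl

    sink-injective : ∀ {i j} → sink i ≡ sink j → i ≡ j
    sink-injective refl = refl

    arc⇒Arc : ∀ {u u′} → arc digraph u u′ ≡ true → Arc (view u) (view u′)
    arc⇒Arc {u} {u′} = does⇒ (arc? (view u) (view u′))

    Arc⇒arc : ∀ {s t} → Arc s t → arc digraph (encode s) (encode t) ≡ true
    Arc⇒arc {s} {t} a =
      subst₂ (λ s′ t′ → does (arc? s′ t′) ≡ true) (sym (view-encode s)) (sym (view-encode t)) (dec-true (arc? s t) a)

    ∈sinks⇒ : ∀ {u} → u ∈ sinks → Σ (Fin 2) λ i → view u ≡ sink i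
    ∈sinks⇒ {u} u∈ with view u | trans (sym (lookup∘tabulate (isSink ∘ view) u)) (∈⇒lookup u∈)
    ... | sink i | _ = i , refl

    ground-arc : ∀ {x s} → Arc (ground x) s → s ≡ hub (column x)
    ground-arc {s = hub v} col≡v = cong hub (sym col≡v)

    hub-arc-nonzero : ∀ {v s} → Arc (hub v) s → v ≢ (false , false)
    hub-arc-nonzero {s = sink zero}       () refl
    hub-arc-nonzero {s = sink (suc zero)} () refl

    fin2-pigeonhole : (a b c : Fin 2) → a ≡ b ⊎ a ≡ c ⊎ b ≡ c
    fin2-pigeonhole zero       zero       _          = inj₁ refl
    fin2-pigeonhole (suc zero) (suc zero) _          = inj₁ refl
    fin2-pigeonhole zero       (suc zero) zero       = inj₂ (inj₁ refl)
    fin2-pigeonhole zero       (suc zero) (suc zero) = inj₂ (inj₂ refl)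
    fin2-pigeonhole (suc zero) zero       zero       = inj₂ (inj₂ refl)
    fin2-pigeonhole (suc zero) zero       (suc zero) = inj₂ (inj₁ refl)

    second-is-hub : ∀ {x l} (vt : Fin (suc (suc l)) → Fin (n + 6)) → vt zero ≡ encode (ground x)
      → arc digraph (vt zero) (vt (suc zero)) ≡ true → view (vt (suc zero)) ≡ hub (column x)
    second-is-hub vt start a =
      ground-arc (subst (λ s → Arc s (view (vt (suc zero)))) (trans (cong view start) (view-encode _)) (arc⇒Arc a))

  through-hub : ∀ {x} (P : PathTo digraph sinks (encode (ground x)))
    → column x ≢ (false , false) × Σ (Fin (suc (len P))) λ i → vert P i ≡ encode (hub (column x))
  through-hub {x} P = go (len P) (vert P) (start P) (finish P) (arcs P)
    where
    go : ∀ l (vt : Fin (suc l) → Fin (n + 6)) → vt zero ≡ encode (ground x) → vt (fromℕ l) ∈ sinks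
       → (∀ i → arc digraph (vt (inject₁ i)) (vt (suc i)) ≡ true)
       → column x ≢ (false , false) × Σ (Fin (suc l)) λ i → vt i ≡ encode (hub (column x))
    go zero vt start end _
      with () ← trans (sym (trans (cong view start) (view-encode (ground x)))) (proj₂ (∈sinks⇒ end))
    go (suc zero) vt start end arcs
      with () ← trans (sym (second-is-hub vt start (arcs zero))) (proj₂ (∈sinks⇒ end))
    go (suc (suc l)) vt start end arcs =
      hub-arc-nonzero (subst (λ s → Arc s (view (vt (suc (suc zero))))) second≡ (arc⇒Arc (arcs (suc zero)))) ,
      suc zero , trans (sym (encode-view _)) (cong encode second≡)
      where
      second≡ : view (vt (suc zero)) ≡ hub (column x)
      second≡ = second-is-hub vt start (arcs zero)

  ends-at-sink : ∀ {s} (P : PathTo digraph sinks s) → Σ (Fin 2) λ i → vert P (fromℕ (len P)) ≡ encode (sink i)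
  ends-at-sink P = let (i , view≡) = ∈sinks⇒ (finish P) in i , trans (sym (encode-view _)) (cong encode view≡)

  linked⇒rank2Independent : ∀ I → LinkedVia digraph sinks (encode ∘ ground) I → Rank2Independent I
  linked⇒rank2Independent I (path , disjoint) = rank2Independent nonzero distinct noThree
    where
    nonzero : ∀ x → x ∈ I → column x ≢ (false , false)
    nonzero x x∈ = proj₁ (through-hub (path x x∈))
    distinct : ∀ x y → x ∈ I → y ∈ I → x ≢ y → column x ≢ column y
    distinct x y x∈ y∈ x≢y col≡ =
      let (i , vi) = proj₂ (through-hub (path x x∈)) ; (j , vj) = proj₂ (through-hub (path y y∈))
      in  disjoint x y x∈ y∈ x≢y i j (trans vi (trans (cong (encode ∘ hub) col≡) (sym vj)))
    noThree : ∀ x y z → x ∈ I → y ∈ I → z ∈ I → x ≢ y → x ≢ z → y ≢ z → Data.Empty.⊥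
    noThree x y z x∈ y∈ z∈ x≢y x≢z y≢z
      with ends-at-sink (path x x∈) | ends-at-sink (path y y∈) | ends-at-sink (path z z∈)
    ... | i , ex | j , ey | k , ez with fin2-pigeonhole i j k
    ... | inj₁ refl        = disjoint x y x∈ y∈ x≢y _ _ (trans ex (sym ey))
    ... | inj₂ (inj₁ refl) = disjoint x z x∈ z∈ x≢z _ _ (trans ex (sym ez))
    ... | inj₂ (inj₂ refl) = disjoint y z y∈ z∈ y≢z _ _ (trans ey (sym ez))

  module Routing {I : Subset n} (indep : Rank2Independent I) where

    open Rank2Independent indep

    hasTF : Dec (Σ (Fin n) λ z → z ∈ I × column z ≡ (true , false))
    hasTF = any? λ z → z ∈? I ×-dec ≡-dec _≟ᵇ_ _≟ᵇ_ (column z) (true , false)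

    -- The column (1,1) takes whichever row the column (1,0), if present in I, leaves free.
    target : Bool × Bool → Fin 2
    target (false , true) = suc zero
    target (true  , true) = if does hasTF then suc zero else zero
    target _              = zero

    target-arc : ∀ v → v ≢ (false , false) → Arc (hub v) (sink (target v))
    target-arc (false , false) v≢ = ⊥-elim (v≢ refl)
    target-arc (false , true)  _  = refl
    target-arc (true  , false) _  = refl
    target-arc (true  , true)  _ with does hasTF
    ... | true  = refl
    ... | false = refl

    route : Fin n → Fin 3 → Vertex
    route x = lookup (ground x ∷ hub (column x) ∷ sink (target (column x)) ∷ [])

    kind : Vertex → Fin 3
    kind (ground _) = zero
    kind (hub _)    = suc zero
    kind (sink _)   = suc (suc zero)

    kind-route : ∀ x i → kind (route x i) ≡ i
    kind-route x zero             = refl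
    kind-route x (suc zero)       = refl
    kind-route x (suc (suc zero)) = refl

    same-kind : ∀ {x y i j} → encode (route x i) ≡ encode (route y j) → i ≡ j
    same-kind {x} {y} {i} {j} eq = trans (sym (kind-route x i)) (trans (cong kind (encode-injective eq)) (kind-route y j))

    path : ∀ x → x ∈ I → PathTo digraph sinks (encode (ground x))
    path x x∈ = record
      { len    = 2
      ; vert   = encode ∘ route x
      ; start  = refl
      ; finish = lookup⇒∈ (trans (lookup∘tabulate (isSink ∘ view) _) (cong isSink (view-encode (sink (target (column x))))))
      ; arcs   = λ { zero → Arc⇒arc {ground x} {hub (column x)} refl
                   ; (suc zero) → Arc⇒arc {hub (column x)} {sink (target (column x))} (target-arc (column x) (nonzero x x∈)) }
      ; simple = λ i j → same-kind
      }

    distinct-targets : ∀ {x y} → x ∈ I → y ∈ I → x ≢ y → target (column x) ≢ target (column y)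
    distinct-targets {x} {y} x∈ y∈ x≢y eq
      with R zero x in a | R (suc zero) x in b | R zero y in a′ | R (suc zero) y in b′
    ... | false | false | _     | _     = nonzero x x∈ (cong₂ _,_ a b)
    ... | _     | _     | false | false = nonzero y y∈ (cong₂ _,_ a′ b′)
    ... | false | true  | false | true  = distinct x y x∈ y∈ x≢y (cong₂ _,_ (trans a (sym a′)) (trans b (sym b′)))
    ... | true  | false | true  | false = distinct x y x∈ y∈ x≢y (cong₂ _,_ (trans a (sym a′)) (trans b (sym b′)))
    ... | true  | true  | true  | true  = distinct x y x∈ y∈ x≢y (cong₂ _,_ (trans a (sym a′)) (trans b (sym b′)))
    ... | true  | false | false | true  = case eq of λ ()
    ... | false | true  | true  | false = case eq of λ ()
    ... | true  | false | true  | true  with hasTF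
    ...   | yes _ = case eq of λ ()
    ...   | no ¬tf = ¬tf (x , x∈ , cong₂ _,_ a b)
    distinct-targets {x} {y} x∈ y∈ x≢y eq
        | true  | true  | true  | false with hasTF
    ...   | yes _ = case eq of λ ()
    ...   | no ¬tf = ¬tf (y , y∈ , cong₂ _,_ a′ b′)
    distinct-targets {x} {y} x∈ y∈ x≢y eq
        | false | true  | true  | true  with hasTF
    ...   | no _ = case eq of λ ()
    ...   | yes (z , z∈ , tf) = noThree z x y z∈ x∈ y∈ (λ { refl → case trans (sym tf) (cong₂ _,_ a b) of λ () })
                                  (λ { refl → case trans (sym tf) (cong₂ _,_ a′ b′) of λ () }) x≢y
    distinct-targets {x} {y} x∈ y∈ x≢y eq
        | true  | true  | false | true  with hasTF
    ...   | no _ = case eq of λ ()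
    ...   | yes (z , z∈ , tf) = noThree z x y z∈ x∈ y∈ (λ { refl → case trans (sym tf) (cong₂ _,_ a b) of λ () })
                                  (λ { refl → case trans (sym tf) (cong₂ _,_ a′ b′) of λ () }) x≢y

    route-disjoint : ∀ {x y} → x ∈ I → y ∈ I → x ≢ y → ∀ i → route x i ≢ route y i
    route-disjoint x∈ y∈ x≢y zero             eq = x≢y (ground-injective eq)
    route-disjoint x∈ y∈ x≢y (suc zero)       eq = distinct _ _ x∈ y∈ x≢y (hub-injective eq)
    route-disjoint x∈ y∈ x≢y (suc (suc zero)) eq = distinct-targets x∈ y∈ x≢y (sink-injective eq)

    disjoint : ∀ x y (x∈ : x ∈ I) (y∈ : y ∈ I) → x ≢ y → ∀ i j → vert (path x x∈) i ≢ vert (path y y∈) j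
    disjoint x y x∈ y∈ x≢y i j eq with same-kind {x} {y} {i} {j} eq
    ... | refl = route-disjoint x∈ y∈ x≢y i (encode-injective eq)

  rank2Independent⇒linked : ∀ I → Rank2Independent I → LinkedVia digraph sinks (encode ∘ ground) I
  rank2Independent⇒linked I r2 = Routing.path r2 , Routing.disjoint r2

  gammoid : IsGammoid M[ R ]
  gammoid = digraph , sinks , encode ∘ ground , (λ x y _ _ → ground-injective ∘ encode-injective) ,
    λ I _ → mk⇔ (rank2Independent⇒linked I ∘ indep⇒rank2Independent) (rank2Independent⇒indep ∘ linked⇒rank2Independent I)

coextension : (A : Matrix m n) (Y T : Subset n) → (splitting A Y ／ T) ≅ MF
  → Σ (Vec Bool 2) λ d → (M[ A ] ／ T) ≅ (M[ d ∷ᶜ Frep ] ／ ⁅ zero ⁆)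
coextension A Y T iso =
  let (d , classify) = trace-classification Frep even⇔null
  in  d , ≅-fromTraces A χ (d ∷ᶜ Frep) dropFirst (λ c → ⇔-sym (trace-∷ᶜ d Frep c) ⇔-∘ classify c)
  where
  χ : Chart T 5
  χ = ≅⇒Chart iso (λ _ → ∈⊤)
  open ParityTraces A (lookup Y) χ
  even-independent : ∀ c → Independent (λ c′ → TraceWith c′ false) c ⇔ Indep M[ Frep ] c
  even-independent c =
    F-represented c ⇔-∘ (≅-Independent iso (λ _ → ∈⊤) c ⇔-∘ Independent-cong (⇔-sym ∘ trace-appendRow) c)
  even⇔null : ∀ c → TraceWith c false ⇔ Null Frep c
  even⇔null = cycleSpace⇔null (λ c → TraceWith c false) (traceWith? false)
                traceWith-⊥ (λ {c} {c′} → traceWith-⊕ {c} {c′}) even-independent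

contracted : {A : Matrix m n} {Y : Subset n}
  → splitting A Y ≅ MF ⊎ Σ (Subset n) (λ Y′ → Y′ ⊆ Y × (splitting A Y ／ Y′) ≅ MF)
  → Σ (Subset n) λ T → T ⊆ Y × (splitting A Y ／ T) ≅ MF
contracted = [ (λ iso → ⊥ , (λ {x} → ⊥⊆ {x = x}) , ≅-／⊥ iso) , id ]′

mainTheorem3 : (m n : ℕ) (A : Matrix m n) → IsGammoid M[ A ]
    → (k : ℕ) (Y : Subset n) → ∣ Y ∣ ≡ k
    → (splitting A Y ≅ MF
        ⊎ Σ (Subset n) (λ Y′ → Y′ ⊆ Y × (splitting A Y ／ Y′) ≅ MF))
    → Σ ℕ (λ q → Σ ℕ (λ r → Σ (Matrix r q) (λ B → IsGammoid M[ B ]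
        × Σ (Fin q) (λ a → (M[ B ] ∖ ⁅ a ⁆) ≅ MF
            × (M[ A ] ≅ (M[ B ] ／ ⁅ a ⁆)
               ⊎ CoextensionAtMost M[ A ] (M[ B ] ／ ⁅ a ⁆) k)))))
mainTheorem3 m n A _ k Y ∣Y∣≡k splitting≅ =
  let (T , T⊆Y , N／T≅MF) = contracted splitting≅
      (d , M／T≅) = coextension A Y T N／T≅MF
  in  6 , 2 , d ∷ᶜ Frep , Rank2.gammoid (d ∷ᶜ Frep) , zero , ∖first≅ d Frep (λ c → ¬ CycleIn F c) F-represented ,
      inj₂ (T , (λ _ → ∈⊤) , subst (∣ T ∣ ≤_) ∣Y∣≡k (p⊆q⇒∣p∣≤∣q∣ T⊆Y) , M／T≅)
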